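{- Let $p\equiv 7\pmod 8$ and $q\equiv 5\pmod 8$ be primes. If there exists an APS$(p,\alpha,\beta)$ for all nonzero $\alpha,\beta\in\mathbb{Z}_p$ with $2\alpha^2-\beta^2\equiv0\pmod p$, then there exists an APS$(pq,\alpha_1,\beta_1)$ for all nonzero $\alpha_1,\beta_1\in\mathbb{Z}_{pq}$ with $2\alpha_1^2-\beta_1^2\equiv 0\pmod{pq}$.
   Context: APS$(n,\alpha,\beta)$ ($n\equiv3\pmod4$, $\alpha,\beta$ nonzero in $\mathbb{Z}_n$): a set $\mathcal S$ of $(n-3)/4$ unordered pairs $\{x,y\}$ from $\mathbb{Z}_n$ with $\bigcup_{\{x,y\}\in\mathcal S}\pm\{x,y\}=\mathbb{Z}_n\setminus\{0,\pm\alpha\}$ and $\bigcup_{\{x,y\}\in\mathcal S}\pm\{x-y,x+y\}=\mathbb{Z}_n\setminus\{0,\pm\beta\}$. -}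

module Defs where

open import Data.Nat using (ℕ; _+_; _*_; _∸_; _/_)
open import Data.Nat.DivMod using ()
open import Data.Fin using (Fin; toℕ)
open import Data.List using (List; length)
open import Data.List.Relation.Unary.Any using (Any)
open import Data.Product using (_×_; _,_; ∃)
open import Data.Sum using (_⊎_)
open import Relation.Nullary using (¬_)
open import Relation.Binary.PropositionalEquality using (_≡_; _≢_)
open import Function.Bundles using (_⇔_)

_≡_[mod_] : ℕ → ℕ → ℕ → Set
a ≡ b [mod n ] = ∃ λ k → (a + k * n ≡ b) ⊎ (b + k * n ≡ a)

-- Elements of ℤ_n are represented by Fin n (residues 0 … n-1).
-- z ∈ ±{w}  in ℤ_n, where w is given by a natural representative.
_∈±_[mod_] : ℕ → ℕ → ℕ → Set
z ∈± w [mod n ] = (z ≡ w [mod n ]) ⊎ ((z + w) ≡ 0 [mod n ])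

_∈±diff_,_[mod_] : ℕ → ℕ → ℕ → ℕ → Set
z ∈±diff x , y [mod n ] = ((z + y) ≡ x [mod n ]) ⊎ ((z + x) ≡ y [mod n ])

-- An unordered pair {x,y} of ℤ_n is represented by an ordered pair (x , y);
-- both conditions below are symmetric in x and y.
Pair : ℕ → Set
Pair n = Fin n × Fin n

InPM : (n : ℕ) → Fin n → Pair n → Set
InPM n z (x , y) = (toℕ z ∈± toℕ x [mod n ]) ⊎ (toℕ z ∈± toℕ y [mod n ])

InPMDS : (n : ℕ) → Fin n → Pair n → Set
InPMDS n z (x , y) = (toℕ z ∈±diff toℕ x , toℕ y [mod n ])
                   ⊎ (toℕ z ∈± (toℕ x + toℕ y) [mod n ])

-- APS(n, α, β): a set S of (n-3)/4 unordered pairs {x,y} from ℤ_n with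
--   ⋃ ±{x,y}       = ℤ_n ∖ {0, ±α}
--   ⋃ ±{x-y, x+y}  = ℤ_n ∖ {0, ±β}
-- (the definition is only used for n ≡ 3 (mod 4) and α, β nonzero).
APS : (n : ℕ) → Fin n → Fin n → Set
APS n α β = ∃ λ (S : List (Pair n)) →
    (length S ≡ (n ∸ 3) / 4)
  × (∀ (z : Fin n) → Any (InPM n z) S
        ⇔ (¬ (toℕ z ≡ 0 [mod n ]) × ¬ (toℕ z ∈± toℕ α [mod n ])))
  × (∀ (z : Fin n) → Any (InPMDS n z) S
        ⇔ (¬ (toℕ z ≡ 0 [mod n ]) × ¬ (toℕ z ∈± toℕ β [mod n ])))

module Submission where

-- Modulo q ≡ 5 (mod 8) the number 2 is not a square (Gauss's lemma), so 2 α₁² ≡ β₁²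
-- (mod pq) forces α₁ = q α and β₁ = q β with 2 α² ≡ β² (mod p), and the hypothesis
-- provides an APS(p, α, β). Its pairs, multiplied by q, take care of the multiples of q.
-- For the units modulo q let √-1 = 2 ^ ((q - 1)/4), let T be a set of (q - 1)/4
-- representatives of the orbits {± u, ± √-1 u}, and let c ≡ 2 (mod p), c ≡ √-1 (mod q).
-- The p (q - 1)/4 pairs {z, c z} with z ≡ u (mod q), u ∈ T, cover the units by ± {z, c z};
-- their differences and sums (1 ∓ c) z cover them as well, because (√-1 + 1) is ± √-1 (√-1 - 1),
-- and 1 - c ≡ -1, 1 + c ≡ 3 are units modulo p. In total there are
-- (p - 3)/4 + p (q - 1)/4 = (pq - 3)/4 pairs.

module Congruence where

  open import Data.Integer using (ℤ; +_; _+_; _*_; _-_; -_; _^_; 0ℤ)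
  open import Data.Integer.Divisibility.Signed
  open import Data.Integer.DivMod using (_%ℕ_; _/ℕ_; a≡a%ℕn+[a/ℕn]*n)
  open import Data.Nat as ℕ using (ℕ; zero; suc; NonZero)
  import Data.Nat.Properties as ℕ
  import Data.Nat.Divisibility as ℕ
  open import Relation.Nullary using (¬_)
  open import Data.Integer.Properties using (neg-involutive; neg-distribˡ-*; neg-distribʳ-*)
  open import Data.Integer.Tactic.RingSolver using (solve-∀)
  open import Data.Sum using (_⊎_; inj₁; inj₂)
  open import Relation.Binary.Bundles using (Setoid)
  open import Relation.Binary.PropositionalEquality using (_≡_; refl; sym; trans; cong; subst)

  infix 4 _≈_[mod_] _≈±_[mod_]

  record _≈_[mod_] (a b n : ℤ) : Set where
    constructor congruent
    field n∣a-b : n ∣ a - b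

  open _≈_[mod_] public

  module _ {n : ℤ} where

    ≈-refl : ∀ {a} → a ≈ a [mod n ]
    ≈-refl {a} = congruent (subst (n ∣_) (lemma a) (divides 0ℤ refl))
      where
      lemma : ∀ a → 0ℤ * n ≡ a - a
      lemma = solve-∀

    ≈-reflexive : ∀ {a b} → a ≡ b → a ≈ b [mod n ]
    ≈-reflexive refl = ≈-refl

    ≈-sym : ∀ {a b} → a ≈ b [mod n ] → b ≈ a [mod n ]
    ≈-sym {a} {b} (congruent d) = congruent (subst (n ∣_) (lemma a b) (∣m⇒∣-m d))
      where
      lemma : ∀ a b → - (a - b) ≡ b - a
      lemma = solve-∀

    ≈-trans : ∀ {a b c} → a ≈ b [mod n ] → b ≈ c [mod n ] → a ≈ c [mod n ]
    ≈-trans {a} {b} {c} (congruent d) (congruent e) =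
      congruent (subst (n ∣_) (lemma a b c) (∣m∣n⇒∣m+n d e))
      where
      lemma : ∀ a b c → (a - b) + (b - c) ≡ a - c
      lemma = solve-∀

    ≈-setoid : Setoid _ _
    ≈-setoid = record
      { Carrier = ℤ
      ; _≈_ = _≈_[mod n ]
      ; isEquivalence = record { refl = ≈-refl ; sym = ≈-sym ; trans = ≈-trans }
      }

    +-cong : ∀ {a b c d} → a ≈ b [mod n ] → c ≈ d [mod n ] → a + c ≈ b + d [mod n ]
    +-cong {a} {b} {c} {d} (congruent ab) (congruent cd) =
      congruent (subst (n ∣_) (lemma a b c d) (∣m∣n⇒∣m+n ab cd))
      where
      lemma : ∀ a b c d → (a - b) + (c - d) ≡ (a + c) - (b + d)
      lemma = solve-∀

    -‿cong : ∀ {a b} → a ≈ b [mod n ] → - a ≈ - b [mod n ]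
    -‿cong {a} {b} (congruent d) = congruent (subst (n ∣_) (lemma a b) (∣m⇒∣-m d))
      where
      lemma : ∀ a b → - (a - b) ≡ - a - - b
      lemma = solve-∀

    *-cong : ∀ {a b c d} → a ≈ b [mod n ] → c ≈ d [mod n ] → a * c ≈ b * d [mod n ]
    *-cong {a} {b} {c} {d} (congruent ab) (congruent cd) =
      congruent (subst (n ∣_) (lemma a b c d) (∣m∣n⇒∣m+n (∣m⇒∣m*n c ab) (∣n⇒∣m*n b cd)))
      where
      lemma : ∀ a b c d → (a - b) * c + b * (c - d) ≡ a * c - b * d
      lemma = solve-∀

    *-congˡ : ∀ c {a b} → a ≈ b [mod n ] → c * a ≈ c * b [mod n ]
    *-congˡ c = *-cong (≈-refl {c})

    *-congʳ : ∀ c {a b} → a ≈ b [mod n ] → a * c ≈ b * c [mod n ]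
    *-congʳ c ab = *-cong ab (≈-refl {c})

    +≈⇒≈- : ∀ {a b c} → a + b ≈ c [mod n ] → a ≈ c - b [mod n ]
    +≈⇒≈- {a} {b} {c} a+b≈c = ≈-trans (≈-reflexive (lemma a b)) (+-cong a+b≈c (≈-refl {a = - b}))
      where
      lemma : ∀ a b → a ≡ a + b - b
      lemma = solve-∀

    ≈-⇒+≈ : ∀ {a b c} → a ≈ c - b [mod n ] → a + b ≈ c [mod n ]
    ≈-⇒+≈ {a} {b} {c} a≈c-b = ≈-trans (+-cong a≈c-b (≈-refl {a = b})) (≈-reflexive (lemma c b))
      where
      lemma : ∀ c b → c - b + b ≡ c
      lemma = solve-∀

    ∣⇒≈0 : ∀ {a} → n ∣ a → a ≈ 0ℤ [mod n ]
    ∣⇒≈0 {a} d = congruent (subst (n ∣_) (lemma a) d)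
      where
      lemma : ∀ a → a ≡ a - 0ℤ
      lemma = solve-∀

    ≈0⇒∣ : ∀ {a} → a ≈ 0ℤ [mod n ] → n ∣ a
    ≈0⇒∣ {a} (congruent d) = subst (n ∣_) (lemma a) d
      where
      lemma : ∀ a → a - 0ℤ ≡ a
      lemma = solve-∀

    ∣-respʳ-≈ : ∀ {a b} → a ≈ b [mod n ] → n ∣ a → n ∣ b
    ∣-respʳ-≈ ab d = ≈0⇒∣ (≈-trans (≈-sym ab) (∣⇒≈0 d))

  0<k<n⇒n∤k : ∀ {n k} → 0 ℕ.< k → k ℕ.< n → ¬ (+ n ∣ + k)
  0<k<n⇒n∤k 0<k k<n n∣k = ℕ.<⇒≱ k<n (ℕ.∣⇒≤ {{ℕ.>-nonZero 0<k}} (∣⇒∣ᵤ n∣k))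

  x≈x%ℕn : ∀ x n .{{_ : NonZero n}} → x ≈ + (x %ℕ n) [mod + n ]
  x≈x%ℕn x n = congruent (divides (x /ℕ n)
    (trans (cong (_- + (x %ℕ n)) (a≡a%ℕn+[a/ℕn]*n x n)) (lemma (+ (x %ℕ n)) (x /ℕ n) (+ n))))
    where
    lemma : ∀ r k n → r + k * n - r ≡ k * n
    lemma = solve-∀

  ^-cong : ∀ {n a b} k → a ≈ b [mod n ] → a ^ k ≈ b ^ k [mod n ]
  ^-cong zero _ = ≈-refl
  ^-cong (suc k) a≈b = *-cong a≈b (^-cong k a≈b)

  ≈-weaken : ∀ {m n a b} → m ∣ n → a ≈ b [mod n ] → a ≈ b [mod m ]
  ≈-weaken m∣n (congruent d) = congruent (∣-trans m∣n d)

  module ≈-Reasoning (n : ℤ) where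
    open import Relation.Binary.Reasoning.Setoid (≈-setoid {n}) public

  _≈±_[mod_] : ℤ → ℤ → ℤ → Set
  a ≈± b [mod n ] = a ≈ b [mod n ] ⊎ a ≈ - b [mod n ]

  module _ {n : ℤ} where

    ≈±-sym : ∀ {a b} → a ≈± b [mod n ] → b ≈± a [mod n ]
    ≈±-sym (inj₁ ab) = inj₁ (≈-sym ab)
    ≈±-sym {a} {b} (inj₂ ab) = inj₂ (≈-trans (≈-reflexive (sym (neg-involutive b))) (-‿cong (≈-sym ab)))

    ≈±-trans : ∀ {a b c} → a ≈± b [mod n ] → b ≈± c [mod n ] → a ≈± c [mod n ]
    ≈±-trans (inj₁ ab) (inj₁ bc) = inj₁ (≈-trans ab bc)
    ≈±-trans (inj₁ ab) (inj₂ bc) = inj₂ (≈-trans ab bc)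
    ≈±-trans (inj₂ ab) (inj₁ bc) = inj₂ (≈-trans ab (-‿cong bc))
    ≈±-trans {c = c} (inj₂ ab) (inj₂ bc) =
      inj₁ (≈-trans ab (≈-trans (-‿cong bc) (≈-reflexive (neg-involutive c))))

    ≈±-resp-≈ : ∀ {a b c} → a ≈± b [mod n ] → b ≈ c [mod n ] → a ≈± c [mod n ]
    ≈±-resp-≈ ab bc = ≈±-trans ab (inj₁ bc)

    ≈±-*-congˡ : ∀ c {a b} → a ≈± b [mod n ] → c * a ≈± c * b [mod n ]
    ≈±-*-congˡ c (inj₁ ab) = inj₁ (*-congˡ c ab)
    ≈±-*-congˡ c {b = b} (inj₂ ab) =
      inj₂ (≈-trans (*-congˡ c ab) (≈-reflexive (sym (neg-distribʳ-* c b))))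

    ≈±-*-congʳ : ∀ c {a b} → a ≈± b [mod n ] → a * c ≈± b * c [mod n ]
    ≈±-*-congʳ c (inj₁ ab) = inj₁ (*-congʳ c ab)
    ≈±-*-congʳ c {b = b} (inj₂ ab) =
      inj₂ (≈-trans (*-congʳ c ab) (≈-reflexive (sym (neg-distribˡ-* b c))))

    ≈±-weaken : ∀ {m a b} → m ∣ n → a ≈± b [mod n ] → a ≈± b [mod m ]
    ≈±-weaken m∣n (inj₁ ab) = inj₁ (≈-weaken m∣n ab)
    ≈±-weaken m∣n (inj₂ ab) = inj₂ (≈-weaken m∣n ab)

    ∣-resp-≈± : ∀ {a b} → a ≈± b [mod n ] → n ∣ b → n ∣ a
    ∣-resp-≈± (inj₁ ab) d = ∣-respʳ-≈ (≈-sym ab) d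
    ∣-resp-≈± (inj₂ ab) d = ∣-respʳ-≈ (≈-sym ab) (∣m⇒∣-m d)

module Fermat where

  open import Data.Fin using (Fin; zero; suc; toℕ; fromℕ)
  open import Data.Fin.Properties using (toℕ-fromℕ)
  open import Data.Integer using (ℤ; +_; _+_; _*_; _-_; _^_; 0ℤ; 1ℤ)
  open import Data.Integer.Divisibility.Signed
  open import Data.Integer.DivMod using (_%ℕ_)
  open import Data.Integer.Properties as ℤ using (+-*-commutativeSemiring; +-*-semiring)
  open import Data.Integer.Tactic.RingSolver using (solve-∀)
  open import Data.Nat as ℕ using (ℕ; zero; suc; _!; _∸_; z≤n; s≤s)
  import Data.Nat.Properties as ℕ
  import Data.Nat.Divisibility as ℕ
  open import Data.Nat.Combinatorics using (_C_; nCk≡n!/k![n-k]!; nCn≡1; nCk≡nC[n∸k]; k![n∸k]!∣n!)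
  open import Data.Nat.DivMod using (m/n*n≡m)
  open import Data.Nat.Primality using (Prime; euclidsLemma; prime⇒nonZero; prime⇒nonTrivial)
  open import Data.Sum using (inj₁; inj₂)
  open import Data.Empty using (⊥-elim)
  open import Relation.Nullary using (¬_)
  open import Relation.Binary.PropositionalEquality

  open import Algebra.Properties.Semiring.Exp +-*-semiring using () renaming (_^_ to _^ᴿ_)
  open import Algebra.Properties.Semiring.Mult +-*-semiring using () renaming (_×_ to _×ᴿ_)
  open import Algebra.Properties.Semiring.Sum +-*-semiring using (sum)
  import Algebra.Properties.CommutativeSemiring.Binomial +-*-commutativeSemiring as Binomial

  open Congruence

  ^≡^ᴿ : ∀ x n → x ^ n ≡ x ^ᴿ n
  ^≡^ᴿ x zero = refl
  ^≡^ᴿ x (suc n) = cong (x *_) (^≡^ᴿ x n)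

  ×ᴿ≡* : ∀ n x → n ×ᴿ x ≡ + n * x
  ×ᴿ≡* zero x = sym (ℤ.*-zeroˡ x)
  ×ᴿ≡* (suc n) x = trans (cong (_+_ x) (×ᴿ≡* n x)) (lemma (+ n) x)
    where
    lemma : ∀ n x → x + n * x ≡ (+ 1 + n) * x
    lemma = solve-∀

  n∣n! : ∀ n .{{_ : ℕ.NonZero n}} → n ℕ.∣ n !
  n∣n! (suc n) = ℕ.m∣m*n (n !)

  module _ {p : ℕ} (p-prime : Prime p) where

    private instance
      p≢0 = prime⇒nonZero p-prime
      p≢1 = prime⇒nonTrivial p-prime

    prime∤k! : ∀ k → k ℕ.< p → ¬ (p ℕ.∣ k !)
    prime∤k! zero _ p∣1 = ℕ.nonTrivial⇒≢1 (ℕ.∣1⇒≡1 p∣1)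
    prime∤k! (suc k) k<p p∣k! with euclidsLemma (suc k) (k !) p-prime p∣k!
    ... | inj₁ p∣k+1 = ℕ.<⇒≱ k<p (ℕ.∣⇒≤ p∣k+1)
    ... | inj₂ p∣k!  = prime∤k! k (ℕ.<-trans (ℕ.n<1+n k) k<p) p∣k!

    -- p divides p! = (p C k) k! (p - k)! but neither k! nor (p - k)!.
    prime∣pCk : ∀ k → 0 ℕ.< k → k ℕ.< p → p ℕ.∣ p C k
    prime∣pCk k 0<k k<p with euclidsLemma (p C k) (k ! ℕ.* (p ∸ k) !) p-prime p∣pCk*k!*[p-k]!
      where
      instance _ = k ℕ.!* (p ∸ k) !≢0
      p∣pCk*k!*[p-k]! : p ℕ.∣ (p C k) ℕ.* (k ! ℕ.* (p ∸ k) !)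
      p∣pCk*k!*[p-k]! = subst (p ℕ.∣_)
        (sym (trans (cong (ℕ._* (k ! ℕ.* (p ∸ k) !)) (nCk≡n!/k![n-k]! (ℕ.<⇒≤ k<p))) (m/n*n≡m (k![n∸k]!∣n! (ℕ.<⇒≤ k<p)))))
        (n∣n! p)
    ... | inj₁ p∣pCk = p∣pCk
    ... | inj₂ p∣k!*[p-k]! with euclidsLemma (k !) ((p ∸ k) !) p-prime p∣k!*[p-k]!
    ...   | inj₁ p∣k! = ⊥-elim (prime∤k! k k<p p∣k!)
    ...   | inj₂ p∣[p-k]! = ⊥-elim (prime∤k! (p ∸ k) (ℕ.∸-monoʳ-< {p} {k} {0} 0<k (ℕ.<⇒≤ k<p)) p∣[p-k]!)

    sum≈last : ∀ m (f : Fin (suc m) → ℤ) → (∀ i → toℕ i ℕ.< m → + p ∣ f i) →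
               sum f ≈ f (fromℕ m) [mod + p ]
    sum≈last zero f _ = ≈-reflexive (ℤ.+-identityʳ (f zero))
    sum≈last (suc m) f p∣f = begin
      f zero + sum (λ i → f (suc i)) ≈⟨ +-cong (∣⇒≈0 (p∣f zero (s≤s z≤n))) p∣rest ⟩
      0ℤ + f (fromℕ (suc m))         ≡⟨ ℤ.+-identityˡ _ ⟩
      f (fromℕ (suc m))              ∎
      where
      open ≈-Reasoning (+ p)
      p∣rest = sum≈last m (λ i → f (suc i)) (λ i i<m → p∣f (suc i) (s≤s i<m))

    sum≈first+last : ∀ n .{{_ : ℕ.NonZero n}} (g : Fin (suc n) → ℤ) →
                     (∀ i → 0 ℕ.< toℕ i → toℕ i ℕ.< n → + p ∣ g i) →
                     sum g ≈ g zero + g (fromℕ n) [mod + p ]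
    sum≈first+last (suc n) g p∣g =
      +-cong (≈-refl {a = g zero}) (sum≈last n (λ i → g (suc i)) (λ i i<n → p∣g (suc i) (s≤s z≤n) (s≤s i<n)))

    open Binomial using (binomialTerm)

    binomialTerm-first : ∀ a → binomialTerm 1ℤ (+ a) p zero ≡ (+ a) ^ p
    binomialTerm-first a = begin
      (p C 0) ×ᴿ ((1ℤ ^ᴿ 0) * (+ a) ^ᴿ p) ≡⟨ cong (_×ᴿ (1ℤ * (+ a) ^ᴿ p)) (trans (nCk≡nC[n∸k] {0} {p} z≤n) (nCn≡1 p)) ⟩
      1 ×ᴿ (1ℤ * (+ a) ^ᴿ p)            ≡⟨ trans (ℤ.+-identityʳ _) (ℤ.*-identityˡ _) ⟩
      (+ a) ^ᴿ p                        ≡⟨ ^≡^ᴿ (+ a) p ⟨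
      (+ a) ^ p                       ∎
      where open ≡-Reasoning

    binomialTerm-last : ∀ a → binomialTerm 1ℤ (+ a) p (fromℕ p) ≡ 1ℤ
    binomialTerm-last a rewrite toℕ-fromℕ p | nCn≡1 p | ℕ.n∸n≡0 p =
      trans (ℤ.+-identityʳ _) (trans (ℤ.*-identityʳ _) (trans (sym (^≡^ᴿ 1ℤ p)) (ℤ.^-zeroˡ p)))

    binomialTerm-middle : ∀ a i → 0 ℕ.< toℕ i → toℕ i ℕ.< p → + p ∣ binomialTerm 1ℤ (+ a) p i
    binomialTerm-middle a i 0<i i<p = subst (+ p ∣_) (sym (×ᴿ≡* (p C toℕ i) _))
      (∣m⇒∣m*n {m = + (p C toℕ i)} (Binomial.binomial 1ℤ (+ a) p i) (∣ᵤ⇒∣ (prime∣pCk (toℕ i) 0<i i<p)))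

    fermat-pos : ∀ a → (+ a) ^ p ≈ + a [mod + p ]
    fermat-pos zero = ≈-reflexive (0^p p)
      where
      0^p : ∀ n .{{_ : ℕ.NonZero n}} → 0ℤ ^ n ≡ 0ℤ
      0^p (suc n) = refl
    fermat-pos (suc a) = begin
      (+ suc a) ^ p                                    ≡⟨ ^≡^ᴿ (1ℤ + + a) p ⟩
      (1ℤ + + a) ^ᴿ p                                 ≡⟨ Binomial.theorem p 1ℤ (+ a) ⟩
      sum (binomialTerm 1ℤ (+ a) p)                   ≈⟨ sum≈first+last p _ (binomialTerm-middle a) ⟩
      binomialTerm 1ℤ (+ a) p zero + binomialTerm 1ℤ (+ a) p (fromℕ p)
                                                      ≡⟨ cong₂ _+_ (binomialTerm-first a) (binomialTerm-last a) ⟩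
      (+ a) ^ p + 1ℤ                                  ≈⟨ +-cong (fermat-pos a) ≈-refl ⟩
      + a + 1ℤ                                        ≡⟨ ℤ.+-comm (+ a) 1ℤ ⟩
      + suc a                                         ∎
      where open ≈-Reasoning (+ p)

    fermat : ∀ x → x ^ p ≈ x [mod + p ]
    fermat x = begin
      x ^ p                ≈⟨ ^-cong p (x≈x%ℕn x p) ⟩
      (+ (x %ℕ p)) ^ p     ≈⟨ fermat-pos (x %ℕ p) ⟩
      + (x %ℕ p)           ≈⟨ x≈x%ℕn x p ⟨
      x                    ∎
      where open ≈-Reasoning (+ p)

module PrimeModulus where

  open import Data.Integer as ℤ using (ℤ; +_; _+_; _*_; _-_; _^_; 1ℤ)
  open import Data.Integer.Divisibility.Signed
  open import Data.Integer.Properties as ℤ using (abs-*)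
  open import Data.Integer.Tactic.RingSolver using (solve-∀)
  open import Data.Nat as ℕ using (ℕ; suc; _∸_)
  import Data.Nat.Properties as ℕ
  import Data.Nat.Divisibility as ℕ
  open import Data.Nat.Primality using (Prime; euclidsLemma; prime⇒irreducible; prime⇒nonZero; prime⇒nonTrivial)
  open import Data.Product using (∃; _×_; _,_)
  open import Data.Sum using (_⊎_; inj₁; inj₂; [_,_]′)
  open import Data.Empty using (⊥-elim)
  open import Relation.Nullary using (¬_)
  open import Relation.Binary.PropositionalEquality

  open Congruence
  open Fermat

  module _ {p : ℕ} (p-prime : Prime p) where

    private instance
      p≢1 = prime⇒nonTrivial p-prime
      p≢0 = prime⇒nonZero p-prime

    prime-∣* : ∀ a b → + p ∣ a * b → + p ∣ a ⊎ + p ∣ b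
    prime-∣* a b p∣ab with euclidsLemma ℤ.∣ a ∣ ℤ.∣ b ∣ p-prime (subst (p ℕ.∣_) (abs-* a b) (∣⇒∣ᵤ p∣ab))
    ... | inj₁ p∣a = inj₁ (∣ᵤ⇒∣ p∣a)
    ... | inj₂ p∣b = inj₂ (∣ᵤ⇒∣ p∣b)

    prime∤1 : ¬ (+ p ∣ 1ℤ)
    prime∤1 p∣1 = ℕ.nonTrivial⇒≢1 (ℕ.∣1⇒≡1 (∣⇒∣ᵤ p∣1))

    prime∤* : ∀ {a b} → ¬ (+ p ∣ a) → ¬ (+ p ∣ b) → ¬ (+ p ∣ a * b)
    prime∤* {a} {b} p∤a p∤b p∣ab = [ p∤a , p∤b ]′ (prime-∣* a b p∣ab)

    prime∣*⇒∣ʳ : ∀ {a b} → ¬ (+ p ∣ a) → + p ∣ a * b → + p ∣ b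
    prime∣*⇒∣ʳ {a} {b} p∤a p∣ab = [ (λ p∣a → ⊥-elim (p∤a p∣a)) , (λ p∣b → p∣b) ]′ (prime-∣* a b p∣ab)

    ≈-cancelˡ : ∀ {c a b} → ¬ (+ p ∣ c) → c * a ≈ c * b [mod + p ] → a ≈ b [mod + p ]
    ≈-cancelˡ {c} {a} {b} p∤c (congruent p∣ca-cb) = congruent (prime∣*⇒∣ʳ p∤c (subst (+ p ∣_) (lemma c a b) p∣ca-cb))
      where
      lemma : ∀ c a b → c * a - c * b ≡ c * (a - b)
      lemma = solve-∀

    fermat-unit : ∀ x → ¬ (+ p ∣ x) → x ^ (p ∸ 1) ≈ 1ℤ [mod + p ]
    fermat-unit x p∤x = congruent (prime∣*⇒∣ʳ p∤x (subst (+ p ∣_) x^p-x≡x[x^p-1-1] (n∣a-b (fermat p-prime x))))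
      where
      x^p≡x*x^p-1 : x ^ p ≡ x * x ^ (p ∸ 1)
      x^p≡x*x^p-1 = cong (x ^_) (sym (ℕ.suc-pred p))
      lemma : ∀ x y → x * y - x ≡ x * (y - 1ℤ)
      lemma = solve-∀
      x^p-x≡x[x^p-1-1] : x ^ p - x ≡ x * (x ^ (p ∸ 1) - 1ℤ)
      x^p-x≡x[x^p-1-1] = trans (cong (_- x) x^p≡x*x^p-1) (lemma x (x ^ (p ∸ 1)))

    -- Opaque, like the other witnesses below: nothing depends on which witness is chosen.
    opaque
      -- Inverses come from Fermat: x · x ^ (p - 2) = x ^ (p - 1) ≡ 1.
      inverse : ∀ x → ¬ (+ p ∣ x) → ∃ λ y → x * y ≈ 1ℤ [mod + p ]
      inverse x p∤x = x ^ (p ∸ 2) , ≈-trans (≈-reflexive (cong (x ^_) p-2+1≡p-1)) (fermat-unit x p∤x)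
        where
        p-2+1≡p-1 : suc (p ∸ 2) ≡ p ∸ 1
        p-2+1≡p-1 = sym (ℕ.+-∸-assoc 1 (ℕ.nonTrivial⇒n>1 p))

  module _ {p q : ℕ} (p-prime : Prime p) (q-prime : Prime q) (p≢q : p ≢ q) where

    q∤p : ¬ (+ q ∣ + p)
    q∤p q∣p with prime⇒irreducible p-prime (∣⇒∣ᵤ q∣p)
    ... | inj₁ q≡1 = ℕ.nonTrivial⇒≢1 {{prime⇒nonTrivial q-prime}} q≡1
    ... | inj₂ q≡p = p≢q (sym q≡p)

    ∣∧∣⇒*∣ : ∀ {x} → + p ∣ x → + q ∣ x → + (p ℕ.* q) ∣ x
    ∣∧∣⇒*∣ (divides k refl) q∣kp with prime∣*⇒∣ʳ q-prime q∤p (subst (+ q ∣_) (ℤ.*-comm k (+ p)) q∣kp)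
    ... | divides j refl = divides j (trans (lemma j (+ q) (+ p)) (cong (j *_) (sym (ℤ.pos-* p q))))
      where
      lemma : ∀ j q p → j * q * p ≡ j * (p * q)
      lemma = solve-∀

    ≈-combine : ∀ {a b} → a ≈ b [mod + p ] → a ≈ b [mod + q ] → a ≈ b [mod + (p ℕ.* q) ]
    ≈-combine (congruent p∣a-b) (congruent q∣a-b) = congruent (∣∧∣⇒*∣ p∣a-b q∣a-b)

    opaque
      crt : ∀ r s → ∃ λ c → c ≈ r [mod + p ] × c ≈ s [mod + q ]
      crt r s with inverse q-prime (+ p) q∤p
      ... | u , pu≈1 = r + + p * u * (s - r) , c≈r , c≈s
        where
        c≈r : r + + p * u * (s - r) ≈ r [mod + p ]
        c≈r = congruent (divides (u * (s - r)) (lemma r (+ p) u s))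
          where
          lemma : ∀ r p u s → r + p * u * (s - r) - r ≡ u * (s - r) * p
          lemma = solve-∀
        c≈s : r + + p * u * (s - r) ≈ s [mod + q ]
        c≈s = ≈-trans (+-cong (≈-refl {a = r}) (*-congʳ (s - r) pu≈1)) (≈-reflexive (lemma r s))
          where
          lemma : ∀ r s → r + 1ℤ * (s - r) ≡ s
          lemma = solve-∀

module FiniteProducts where

  open import Data.Integer as ℤ using (ℤ; +_; _*_; _^_; 1ℤ)
  open import Data.Integer.Divisibility.Signed using (_∣_)
  import Data.Integer.Properties as ℤ
  open import Data.Integer.Tactic.RingSolver using (solve-∀)
  open import Data.Nat as ℕ using (ℕ; zero; suc; _∸_)
  import Data.Nat.Properties as ℕ
  open import Data.Nat.Primality using (Prime)
  open import Relation.Nullary using (¬_)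
  open import Relation.Binary.PropositionalEquality

  open Congruence
  open PrimeModulus using (prime∤1; prime∤*)

  ∏ : ℕ → (ℕ → ℤ) → ℤ
  ∏ zero f = 1ℤ
  ∏ (suc n) f = f n * ∏ n f

  ∏-split : ∀ m n f → ∏ (n ℕ.+ m) f ≡ ∏ m f * ∏ n (λ j → f (m ℕ.+ j))
  ∏-split m zero f = sym (ℤ.*-identityʳ (∏ m f))
  ∏-split m (suc n) f = begin
    f (n ℕ.+ m) * ∏ (n ℕ.+ m) f                         ≡⟨ cong₂ _*_ (cong f (ℕ.+-comm n m)) (∏-split m n f) ⟩
    f (m ℕ.+ n) * (∏ m f * ∏ n (λ j → f (m ℕ.+ j)))     ≡⟨ lemma (f (m ℕ.+ n)) (∏ m f) _ ⟩
    ∏ m f * (f (m ℕ.+ n) * ∏ n (λ j → f (m ℕ.+ j)))     ∎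
    where
    open ≡-Reasoning
    lemma : ∀ x y z → x * (y * z) ≡ y * (x * z)
    lemma = solve-∀

  ∏-* : ∀ n f g → ∏ n (λ j → f j * g j) ≡ ∏ n f * ∏ n g
  ∏-* zero f g = refl
  ∏-* (suc n) f g = trans (cong (f n * g n *_) (∏-* n f g)) (lemma (f n) (g n) (∏ n f) (∏ n g))
    where
    lemma : ∀ a b c d → a * b * (c * d) ≡ a * c * (b * d)
    lemma = solve-∀

  ∏-const : ∀ n c → ∏ n (λ _ → c) ≡ c ^ n
  ∏-const zero c = refl
  ∏-const (suc n) c = cong (c *_) (∏-const n c)

  ∏-reverse : ∀ n f → ∏ n (λ j → f (n ∸ suc j)) ≡ ∏ n f
  ∏-reverse zero f = refl
  ∏-reverse (suc n) f = begin
    ∏ (suc n) g                               ≡⟨ cong (λ k → ∏ k g) (ℕ.+-comm 1 n) ⟩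
    ∏ (n ℕ.+ 1) g                             ≡⟨ ∏-split 1 n g ⟩
    f n * 1ℤ * ∏ n (λ j → f (n ∸ suc j))      ≡⟨ cong₂ _*_ (ℤ.*-identityʳ (f n)) (∏-reverse n f) ⟩
    f n * ∏ n f                               ∎
    where
    open ≡-Reasoning
    g = λ j → f (suc n ∸ suc j)

  ∏-cong : ∀ {m} n {f g} → (∀ j → j ℕ.< n → f j ≈ g j [mod m ]) → ∏ n f ≈ ∏ n g [mod m ]
  ∏-cong zero _ = ≈-refl
  ∏-cong (suc n) f≈g = *-cong (f≈g n (ℕ.n<1+n n)) (∏-cong n (λ j j<n → f≈g j (ℕ.m<n⇒m<1+n j<n)))

  ∏-prime∤ : ∀ {p} → Prime p → ∀ n f → (∀ j → j ℕ.< n → ¬ (+ p ∣ f j)) → ¬ (+ p ∣ ∏ n f)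
  ∏-prime∤ p-prime zero f _ = prime∤1 p-prime
  ∏-prime∤ p-prime (suc n) f p∤f =
    prime∤* p-prime (p∤f n (ℕ.n<1+n n)) (∏-prime∤ p-prime n f (λ j j<n → p∤f j (ℕ.m<n⇒m<1+n j<n)))

module TwoNonResidue where

  open import Data.Integer as ℤ using (ℤ; +_; _+_; _*_; _-_; -_; _^_; 1ℤ)
  open import Data.Integer.Divisibility.Signed
  import Data.Integer.Properties as ℤ
  open import Data.Integer.Tactic.RingSolver using (solve-∀)
  open import Data.Nat as ℕ using (ℕ; zero; suc; _∸_; z≤n; s≤s)
  import Data.Nat.Properties as ℕ
  import Data.Nat.Tactic.RingSolver as ℕ-Solver
  open import Data.Nat.Primality using (Prime)
  open import Data.Product using (_,_)
  open import Data.Sum as Sum using (inj₁; inj₂)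
  open import Data.Empty using (⊥-elim)
  open import Relation.Nullary using (¬_; yes; no)
  open import Relation.Binary.PropositionalEquality

  open Congruence
  open PrimeModulus
  open FiniteProducts

  factorial : ℕ → ℤ
  factorial n = ∏ n (λ j → + suc j)

  oddFactorial : ℕ → ℤ
  oddFactorial n = ∏ n (λ j → + 2 * + j + 1ℤ)

  factorial-double : ∀ n → factorial (n ℕ.+ n) ≡ oddFactorial n * ((+ 2) ^ n * factorial n)
  factorial-double zero = refl
  factorial-double (suc n) = begin
    factorial (suc n ℕ.+ suc n)
      ≡⟨ cong (λ k → factorial (suc k)) (ℕ.+-suc n n) ⟩
    + suc (suc (n ℕ.+ n)) * (+ suc (n ℕ.+ n) * factorial (n ℕ.+ n))
      ≡⟨ cong (λ m → (1ℤ + (1ℤ + m)) * ((1ℤ + m) * factorial (n ℕ.+ n))) (ℤ.pos-+ n n) ⟩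
    (1ℤ + (1ℤ + (+ n + + n))) * ((1ℤ + (+ n + + n)) * factorial (n ℕ.+ n))
      ≡⟨ cong (λ f → (1ℤ + (1ℤ + (+ n + + n))) * ((1ℤ + (+ n + + n)) * f)) (factorial-double n) ⟩
    (1ℤ + (1ℤ + (+ n + + n))) * ((1ℤ + (+ n + + n)) * (oddFactorial n * ((+ 2) ^ n * factorial n)))
      ≡⟨ lemma (+ n) (oddFactorial n) ((+ 2) ^ n) (factorial n) ⟩
    (+ 2 * + n + 1ℤ) * oddFactorial n * (+ 2 * (+ 2) ^ n * ((1ℤ + + n) * factorial n))
      ∎
    where
    open ≡-Reasoning
    lemma : ∀ n o e f → (1ℤ + (1ℤ + (n + n))) * ((1ℤ + (n + n)) * (o * (e * f)))
                      ≡ (+ 2 * n + 1ℤ) * o * (+ 2 * e * ((1ℤ + n) * f))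
    lemma = solve-∀

  ^-square : ∀ x n → (x * x) ^ n ≡ x ^ (n ℕ.+ n)
  ^-square x zero = refl
  ^-square x (suc n) = begin
    x * x * (x * x) ^ n       ≡⟨ cong (x * x *_) (^-square x n) ⟩
    x * x * x ^ (n ℕ.+ n)     ≡⟨ ℤ.*-assoc x x _ ⟩
    x * (x * x ^ (n ℕ.+ n))   ≡⟨ cong (λ k → x * x ^ k) (ℕ.+-suc n n) ⟨
    x * x ^ (n ℕ.+ suc n)     ∎
    where open ≡-Reasoning

  [-1]^odd : ∀ t → (- 1ℤ) ^ suc (t ℕ.+ t) ≡ - 1ℤ
  [-1]^odd zero = refl
  [-1]^odd (suc t) = begin
    - 1ℤ * (- 1ℤ * (- 1ℤ) ^ (t ℕ.+ suc t)) ≡⟨ cong (λ k → - 1ℤ * (- 1ℤ * (- 1ℤ) ^ k)) (ℕ.+-suc t t) ⟩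
    - 1ℤ * (- 1ℤ * (- 1ℤ) ^ suc (t ℕ.+ t)) ≡⟨ cong (λ x → - 1ℤ * (- 1ℤ * x)) ([-1]^odd t) ⟩
    - 1ℤ                                    ∎
    where open ≡-Reasoning

  module FiveModEight {q : ℕ} (q-prime : Prime q) (t : ℕ) (q≡8t+5 : q ≡ 8 ℕ.* t ℕ.+ 5) where

    h : ℕ
    h = suc (t ℕ.+ t)

    q≡4h+1 : q ≡ suc ((h ℕ.+ h) ℕ.+ (h ℕ.+ h))
    q≡4h+1 = trans q≡8t+5 (lemma t)
      where
      lemma : ∀ t → 8 ℕ.* t ℕ.+ 5 ≡ suc ((suc (t ℕ.+ t) ℕ.+ suc (t ℕ.+ t)) ℕ.+ (suc (t ℕ.+ t) ℕ.+ suc (t ℕ.+ t)))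
      lemma = ℕ-Solver.solve-∀

    +q≡4h+1 : + q ≡ + 4 * + h + 1ℤ
    +q≡4h+1 = trans (cong +_ (trans q≡8t+5 (lemma t))) (trans (ℤ.pos-+ (4 ℕ.* h) 1) (cong (_+ 1ℤ) (ℤ.pos-* 4 h)))
      where
      lemma : ∀ t → 8 ℕ.* t ℕ.+ 5 ≡ 4 ℕ.* suc (t ℕ.+ t) ℕ.+ 1
      lemma = ℕ-Solver.solve-∀

    q∤2 : ¬ (+ q ∣ + 2)
    q∤2 = 0<k<n⇒n∤k (s≤s z≤n) (ℕ.<-≤-trans (s≤s (s≤s (s≤s z≤n))) (subst (5 ℕ.≤_) (sym q≡8t+5) (ℕ.m≤n+m 5 (8 ℕ.* t))))

    -- 2 (h + j + 1) + (2 (h - 1 - j) + 1) = 4 h + 1 = q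
    upper-half : ∀ j → j ℕ.< h → + 2 * + suc (h ℕ.+ j) ≈ - 1ℤ * (+ 2 * + (h ∸ suc j) + 1ℤ) [mod + q ]
    upper-half j j<h = congruent (divides 1ℤ (begin
        + 2 * + suc (h ℕ.+ j) - - 1ℤ * (+ 2 * + u + 1ℤ) ≡⟨ cong (λ k → + 2 * + suc k - - 1ℤ * (+ 2 * + u + 1ℤ)) h+j≡u+j+1+j ⟩
        + 2 * + suc (u ℕ.+ suc j ℕ.+ j) - - 1ℤ * (+ 2 * + u + 1ℤ)
          ≡⟨ cong (λ k → + 2 * (1ℤ + k) - - 1ℤ * (+ 2 * + u + 1ℤ)) (ℤ.pos-+ (u ℕ.+ suc j) j) ⟩
        + 2 * (1ℤ + (+ (u ℕ.+ suc j) + + j)) - - 1ℤ * (+ 2 * + u + 1ℤ)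
          ≡⟨ cong (λ k → + 2 * (1ℤ + (k + + j)) - - 1ℤ * (+ 2 * + u + 1ℤ)) (ℤ.pos-+ u (suc j)) ⟩
        + 2 * (1ℤ + ((+ u + (1ℤ + + j)) + + j)) - - 1ℤ * (+ 2 * + u + 1ℤ) ≡⟨ lemma (+ u) (+ j) ⟩
        1ℤ * (+ 4 * (+ u + (1ℤ + + j)) + 1ℤ) ≡⟨ cong (λ k → 1ℤ * (+ 4 * k + 1ℤ)) (ℤ.pos-+ u (suc j)) ⟨
        1ℤ * (+ 4 * + h′ + 1ℤ) ≡⟨ cong (λ k → 1ℤ * (+ 4 * + k + 1ℤ)) (ℕ.m∸n+n≡m j<h) ⟩
        1ℤ * (+ 4 * + h + 1ℤ) ≡⟨ cong (1ℤ *_) +q≡4h+1 ⟨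
        1ℤ * + q ∎))
      where
      open ≡-Reasoning
      u = h ∸ suc j
      h′ = u ℕ.+ suc j
      h+j≡u+j+1+j : h ℕ.+ j ≡ h′ ℕ.+ j
      h+j≡u+j+1+j = cong (ℕ._+ j) (sym (ℕ.m∸n+n≡m j<h))
      lemma : ∀ u j → + 2 * (1ℤ + ((u + (1ℤ + j)) + j)) - - 1ℤ * (+ 2 * u + 1ℤ)
                    ≡ 1ℤ * (+ 4 * (u + (1ℤ + j)) + 1ℤ)
      lemma = solve-∀

    -- Gauss's lemma for 2: the even numbers 2, 4, …, 4h are, up to sign, the
    -- numbers 1, …, 2h, and exactly h of them need a sign change.
    2^[2h]*[2h]!≈-[2h]! : (+ 2) ^ (h ℕ.+ h) * factorial (h ℕ.+ h) ≈ - factorial (h ℕ.+ h) [mod + q ]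
    2^[2h]*[2h]!≈-[2h]! = begin
      (+ 2) ^ (h ℕ.+ h) * factorial (h ℕ.+ h)
        ≡⟨ cong (_* factorial (h ℕ.+ h)) (∏-const (h ℕ.+ h) (+ 2)) ⟨
      ∏ (h ℕ.+ h) (λ _ → + 2) * factorial (h ℕ.+ h)
        ≡⟨ ∏-* (h ℕ.+ h) (λ _ → + 2) (λ j → + suc j) ⟨
      ∏ (h ℕ.+ h) evens
        ≡⟨ ∏-split h h evens ⟩
      ∏ h evens * ∏ h (λ j → evens (h ℕ.+ j))
        ≈⟨ *-congˡ (∏ h evens) (∏-cong h upper-half) ⟩
      ∏ h evens * ∏ h (λ j → - 1ℤ * odd (h ∸ suc j))
        ≡⟨ cong₂ _*_ (∏-* h (λ _ → + 2) (λ j → + suc j)) (∏-* h (λ _ → - 1ℤ) (λ j → odd (h ∸ suc j))) ⟩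
      ∏ h (λ _ → + 2) * factorial h * (∏ h (λ _ → - 1ℤ) * ∏ h (λ j → odd (h ∸ suc j)))
        ≡⟨ cong₂ (λ x y → x * factorial h * y) (∏-const h (+ 2))
                 (cong₂ _*_ (trans (∏-const h (- 1ℤ)) ([-1]^odd t)) (∏-reverse h odd)) ⟩
      (+ 2) ^ h * factorial h * (- 1ℤ * oddFactorial h)
        ≡⟨ lemma ((+ 2) ^ h) (factorial h) (oddFactorial h) ⟩
      - (oddFactorial h * ((+ 2) ^ h * factorial h))
        ≡⟨ cong -_ (factorial-double h) ⟨
      - factorial (h ℕ.+ h) ∎
      where
      open ≈-Reasoning (+ q)
      evens odd : ℕ → ℤ
      evens j = + 2 * + suc j
      odd k = + 2 * + k + 1ℤ
      lemma : ∀ e f o → e * f * (- 1ℤ * o) ≡ - (o * (e * f))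
      lemma = solve-∀

    q∤[2h]! : ¬ (+ q ∣ factorial (h ℕ.+ h))
    q∤[2h]! = ∏-prime∤ q-prime (h ℕ.+ h) (λ j → + suc j)
      (λ j j<2h → 0<k<n⇒n∤k (s≤s z≤n) (ℕ.<-≤-trans (s≤s j<2h) 2h<q))
      where
      2h<q : suc (h ℕ.+ h) ℕ.≤ q
      2h<q = subst (suc (h ℕ.+ h) ℕ.≤_) (sym q≡4h+1) (s≤s (ℕ.m≤m+n _ _))

    2^[2h]≈-1 : (+ 2) ^ (h ℕ.+ h) ≈ - 1ℤ [mod + q ]
    2^[2h]≈-1 = congruent (subst (+ q ∣_) (lemma ((+ 2) ^ (h ℕ.+ h))) (prime∣*⇒∣ʳ q-prime q∤[2h]!
      (subst (+ q ∣_) (factor ((+ 2) ^ (h ℕ.+ h)) (factorial (h ℕ.+ h))) (n∣a-b 2^[2h]*[2h]!≈-[2h]!))))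
      where
      factor : ∀ e f → e * f - - f ≡ f * (e + 1ℤ)
      factor = solve-∀
      lemma : ∀ e → e + 1ℤ ≡ e - - 1ℤ
      lemma = solve-∀

    2-nonresidue : ∀ x → ¬ (x * x ≈ + 2 [mod + q ])
    2-nonresidue x x²≈2 = q∤2 (∣m⇒∣-m (n∣a-b -1≈1))
      where
      q∤x : ¬ (+ q ∣ x)
      q∤x q∣x = q∤2 (∣-respʳ-≈ x²≈2 (∣m⇒∣m*n x q∣x))
      q-1≡4h : q ∸ 1 ≡ (h ℕ.+ h) ℕ.+ (h ℕ.+ h)
      q-1≡4h = cong (_∸ 1) q≡4h+1
      -1≈1 : - 1ℤ ≈ 1ℤ [mod + q ]
      -1≈1 = begin
        - 1ℤ                        ≈⟨ 2^[2h]≈-1 ⟨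
        (+ 2) ^ (h ℕ.+ h)             ≈⟨ ^-cong (h ℕ.+ h) x²≈2 ⟨
        (x * x) ^ (h ℕ.+ h)         ≡⟨ trans (^-square x (h ℕ.+ h)) (cong (x ^_) (sym q-1≡4h)) ⟩
        x ^ (q ∸ 1)                 ≈⟨ fermat-unit q-prime x q∤x ⟩
        1ℤ                          ∎
        where open ≈-Reasoning (+ q)

    opaque
      √-1 : ℤ
      √-1 = (+ 2) ^ h

      √-1²≈-1 : √-1 * √-1 ≈ - 1ℤ [mod + q ]
      √-1²≈-1 = ≈-trans (≈-reflexive (sym (ℤ.^-distribˡ-+-* (+ 2) h h))) 2^[2h]≈-1

    q∤√-1 : ¬ (+ q ∣ √-1)
    q∤√-1 q∣i = prime∤1 q-prime (∣m⇒∣-m (∣-respʳ-≈ √-1²≈-1 (∣m⇒∣m*n √-1 q∣i)))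

    [√-1-1][√-1+1]≈-2 : (√-1 - 1ℤ) * (√-1 + 1ℤ) ≈ - + 2 [mod + q ]
    [√-1-1][√-1+1]≈-2 = ≈-trans (≈-reflexive (lemma √-1)) (+-cong √-1²≈-1 (≈-refl {a = - 1ℤ}))
      where
      lemma : ∀ i → (i - 1ℤ) * (i + 1ℤ) ≡ i * i - 1ℤ
      lemma = solve-∀

    q∤√-1-1 : ¬ (+ q ∣ √-1 - 1ℤ)
    q∤√-1-1 q∣i-1 = q∤2 (∣m⇒∣-m (∣-respʳ-≈ [√-1-1][√-1+1]≈-2 (∣m⇒∣m*n (√-1 + 1ℤ) q∣i-1)))

    q∤√-1+1 : ¬ (+ q ∣ √-1 + 1ℤ)
    q∤√-1+1 q∣i+1 = q∤2 (∣m⇒∣-m (∣-respʳ-≈ [√-1-1][√-1+1]≈-2 (∣n⇒∣m*n (√-1 - 1ℤ) q∣i+1)))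

    2a²≈b²⇒q∣a : ∀ a b → + 2 * (a * a) ≈ b * b [mod + q ] → + q ∣ a
    2a²≈b²⇒q∣a a b 2a²≈b² with + q ∣? a
    ... | yes q∣a = q∣a
    ... | no q∤a with inverse q-prime a q∤a
    ...   | a⁻¹ , aa⁻¹≈1 = ⊥-elim (2-nonresidue (b * a⁻¹) (begin
      b * a⁻¹ * (b * a⁻¹)            ≡⟨ lemma₁ b a⁻¹ ⟩
      b * b * (a⁻¹ * a⁻¹)            ≈⟨ *-congʳ (a⁻¹ * a⁻¹) 2a²≈b² ⟨
      + 2 * (a * a) * (a⁻¹ * a⁻¹)    ≡⟨ lemma₂ a a⁻¹ ⟩
      + 2 * ((a * a⁻¹) * (a * a⁻¹))  ≈⟨ *-congˡ (+ 2) (*-cong aa⁻¹≈1 aa⁻¹≈1) ⟩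
      + 2                            ∎))
      where
      open ≈-Reasoning (+ q)
      lemma₁ : ∀ b c → b * c * (b * c) ≡ b * b * (c * c)
      lemma₁ = solve-∀
      lemma₂ : ∀ a c → + 2 * (a * a) * (c * c) ≡ + 2 * ((a * c) * (a * c))
      lemma₂ = solve-∀

    2a²≈b²⇒q∣b : ∀ a b → + 2 * (a * a) ≈ b * b [mod + q ] → + q ∣ b
    2a²≈b²⇒q∣b a b 2a²≈b² = Sum.reduce (prime-∣* q-prime b b q∣b²)
      where
      q∣b² : + q ∣ b * b
      q∣b² = ∣-respʳ-≈ 2a²≈b² (∣n⇒∣m*n (+ 2) (∣m⇒∣m*n a (2a²≈b²⇒q∣a a b 2a²≈b²)))

    ≉±√-1* : ∀ {x} → ¬ (+ q ∣ x) → ¬ (x ≈± √-1 * x [mod + q ])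
    ≉±√-1* {x} q∤x (inj₁ (congruent q∣x-ix)) =
      prime∤* q-prime q∤x q∤√-1-1 (subst (+ q ∣_) (lemma x √-1) (∣m⇒∣-m q∣x-ix))
      where
      lemma : ∀ x i → - (x - i * x) ≡ x * (i - 1ℤ)
      lemma = solve-∀
    ≉±√-1* {x} q∤x (inj₂ (congruent q∣x+ix)) =
      prime∤* q-prime q∤x q∤√-1+1 (subst (+ q ∣_) (lemma x √-1) q∣x+ix)
      where
      lemma : ∀ x i → x - - (i * x) ≡ x * (i + 1ℤ)
      lemma = solve-∀

module HalfSystem where

  open import Data.Integer as ℤ using (ℤ; +_; _+_; _-_; -_; 0ℤ)
  open import Data.Integer.Divisibility.Signed
  open import Data.Integer.DivMod using (_%ℕ_; n%ℕd<d)
  import Data.Integer.Properties as ℤ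
  open import Data.Integer.Tactic.RingSolver using (solve-∀)
  open import Data.Nat as ℕ using (ℕ; zero; suc; _∸_; _≤_; _<_; z≤n; s≤s; _≤?_)
  import Data.Nat.Properties as ℕ
  open import Data.Product using (_×_; _,_)
  open import Data.Sum using (inj₁; inj₂)
  open import Data.Empty using (⊥-elim)
  open import Relation.Nullary using (¬_; yes; no)
  open import Relation.Binary.Definitions using (tri<; tri≈; tri>)
  open import Relation.Binary.PropositionalEquality

  open Congruence

  InHalf : ℕ → ℕ → Set
  InHalf m u = 1 ≤ u × u ≤ m

  module _ {n : ℕ} (m : ℕ) (n≡2m+1 : n ≡ suc (m ℕ.+ m)) where

    private
      instance
        n≢0 : ℕ.NonZero n
        n≢0 = subst ℕ.NonZero (sym n≡2m+1) _
      ≤m⇒<n : ∀ {u} → u ≤ m → u < n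
      ≤m⇒<n u≤m = subst (_ <_) (sym n≡2m+1) (s≤s (ℕ.≤-trans u≤m (ℕ.m≤m+n m m)))

    fold : ℕ → ℕ
    fold r with r ≤? m
    ... | yes _ = r
    ... | no _ = n ∸ r

    rep : ℤ → ℕ
    rep x = fold (x %ℕ n)

    n≈0 : + n ≈ 0ℤ [mod + n ]
    n≈0 = ∣⇒≈0 ∣-refl

    pos-∸ : ∀ a b → b ≤ a → + (a ∸ b) ≡ + a - + b
    pos-∸ a b b≤a = trans (sym (ℤ.⊖-≥ b≤a)) (sym (ℤ.m-n≡m⊖n a b))

    rep-≈± : ∀ x → + rep x ≈± x [mod + n ]
    rep-≈± x = fold-≈± (x %ℕ n) (≈-sym (x≈x%ℕn x n)) (n%ℕd<d x n)
      where
      fold-≈± : ∀ r → + r ≈ x [mod + n ] → r < n → + fold r ≈± x [mod + n ]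
      fold-≈± r r≈x r<n with r ≤? m
      ... | yes _ = inj₁ r≈x
      ... | no _ = inj₂ (≈-trans (≈-reflexive (pos-∸ n r (ℕ.<⇒≤ r<n)))
                        (≈-trans (+-cong n≈0 (-‿cong r≈x)) (≈-reflexive (ℤ.+-identityˡ (- x)))))

    n∤InHalf : ∀ {u} → InHalf m u → ¬ (+ n ∣ + u)
    n∤InHalf (1≤u , u≤m) = 0<k<n⇒n∤k 1≤u (≤m⇒<n u≤m)

    rep-InHalf : ∀ x → ¬ (+ n ∣ x) → InHalf m (rep x)
    rep-InHalf x n∤x = fold-InHalf (x %ℕ n) (≈-sym (x≈x%ℕn x n)) (n%ℕd<d x n)
      where
      fold-InHalf : ∀ r → + r ≈ x [mod + n ] → r < n → InHalf m (fold r)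
      fold-InHalf r r≈x r<n with r ≤? m
      fold-InHalf zero r≈x r<n | yes _ = ⊥-elim (n∤x (∣-respʳ-≈ r≈x (divides 0ℤ refl)))
      fold-InHalf (suc r) r≈x r<n | yes r≤m = s≤s z≤n , r≤m
      ... | no r≰m = ℕ.m<n⇒0<n∸m r<n , ℕ.≤-trans (ℕ.∸-monoʳ-≤ n (ℕ.≰⇒> r≰m)) (ℕ.≤-reflexive (trans (cong (_∸ suc m) n≡2m+1) (ℕ.m+n∸m≡n (suc m) m)))

    InHalf-≈±-injective : ∀ {u v} → InHalf m u → InHalf m v → + u ≈± + v [mod + n ] → u ≡ v
    InHalf-≈±-injective {u} {v} (1≤u , u≤m) (1≤v , v≤m) (inj₁ (congruent n∣u-v)) with ℕ.<-cmp u v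
    ... | tri≈ _ u≡v _ = u≡v
    ... | tri< u<v _ _ = ⊥-elim (n∤InHalf (ℕ.m<n⇒0<n∸m u<v , ℕ.≤-trans (ℕ.m∸n≤m v u) v≤m)
                           (subst (+ n ∣_) (trans (lemma (+ u) (+ v)) (sym (pos-∸ v u (ℕ.<⇒≤ u<v)))) (∣m⇒∣-m n∣u-v)))
      where
      lemma : ∀ a b → - (a - b) ≡ b - a
      lemma = solve-∀
    ... | tri> _ _ v<u = ⊥-elim (n∤InHalf (ℕ.m<n⇒0<n∸m v<u , ℕ.≤-trans (ℕ.m∸n≤m u v) u≤m)
                           (subst (+ n ∣_) (sym (pos-∸ u v (ℕ.<⇒≤ v<u))) n∣u-v))
    InHalf-≈±-injective {u} {v} (1≤u , u≤m) (1≤v , v≤m) (inj₂ (congruent n∣u+v)) =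
      ⊥-elim (0<k<n⇒n∤k (ℕ.≤-trans 1≤u (ℕ.m≤m+n u v)) (subst (_ <_) (sym n≡2m+1) (s≤s (ℕ.+-mono-≤ u≤m v≤m)))
        (subst (+ n ∣_) (trans (lemma (+ u) (+ v)) (sym (ℤ.pos-+ u v))) n∣u+v))
      where
      lemma : ∀ a b → a - - b ≡ a + b
      lemma = solve-∀

module Transversal where

  open import Data.Nat as ℕ using (ℕ; zero; suc; _+_; _≤_; s≤s)
  import Data.Nat.Properties as ℕ
  open import Data.List using (List; []; _∷_; length; filter)
  open import Data.List.Properties using (filter-all; filter-accept; filter-reject)
  open import Data.List.Relation.Unary.All as All using (All; []; _∷_)
  open import Data.List.Relation.Unary.Any using (here; there)
  open import Data.List.Membership.Propositional using (_∈_)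
  open import Data.List.Membership.Propositional.Properties using (∈-filter⁺; ∈-filter⁻)
  open import Data.List.Relation.Unary.Unique.Propositional using (Unique; []; _∷_)
  import Data.List.Relation.Unary.Unique.Propositional.Properties as Unique
  open import Data.Product using (_×_; _,_; ∃; proj₁)
  open import Data.Sum using (_⊎_; inj₁; inj₂)
  open import Data.Empty using (⊥-elim)
  open import Relation.Nullary using (¬_; yes; no; ¬?)
  open import Relation.Binary.Definitions using (DecidableEquality)
  open import Relation.Binary.PropositionalEquality

  module _ {A : Set} (σ : A → A) where

    Closed : List A → Set
    Closed L = ∀ {x} → x ∈ L → σ x ∈ L

    record IsTransversal (T L : List A) : Set where
      field
        length-half : length L ≡ length T + length T
        covers : ∀ {x} → x ∈ L → ∃ λ t → t ∈ T × (x ≡ t ⊎ x ≡ σ t)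
        sub : ∀ {t} → t ∈ T → t ∈ L

  module _ {A : Set} (_≟_ : DecidableEquality A) (σ : A → A) where

    remove : A → List A → List A
    remove s = filter (λ y → ¬? (y ≟ s))

    length-remove : ∀ {s xs} → Unique xs → s ∈ xs → suc (length (remove s xs)) ≡ length xs
    length-remove {s} {x ∷ xs} (x∉xs ∷ _) (here refl) =
      cong (λ l → suc (length l)) (trans (filter-reject (λ y → ¬? (y ≟ s)) (λ ¬x≢x → ¬x≢x refl))
                                         (filter-all (λ y → ¬? (y ≟ s)) (All.map (λ x≢y y≡x → x≢y (sym y≡x)) x∉xs)))
    length-remove {s} {x ∷ xs} (x∉xs ∷ u) (there s∈xs) =
      trans (cong (λ l → suc (length l)) (filter-accept (λ y → ¬? (y ≟ s)) (All.lookup x∉xs s∈xs)))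
            (cong suc (length-remove u s∈xs))

    transversal : ℕ → List A → List A
    transversal zero _ = []
    transversal (suc fuel) [] = []
    transversal (suc fuel) (x ∷ xs) = x ∷ transversal fuel (remove (σ x) xs)

    module _ (P : A → Set)
             (σ-resp : ∀ {x} → P x → P (σ x))
             (σ-involutive : ∀ {x} → P x → σ (σ x) ≡ x)
             (σ-fixfree : ∀ {x} → P x → σ x ≢ x) where

      σ-injective : ∀ {y z} → P y → P z → σ y ≡ σ z → y ≡ z
      σ-injective Py Pz σy≡σz = trans (sym (σ-involutive Py)) (trans (cong σ σy≡σz) (σ-involutive Pz))

      partner∈ : ∀ {x xs} → P x → Closed σ (x ∷ xs) → σ x ∈ xs
      partner∈ Px closed with closed (here refl)
      ... | here σx≡x = ⊥-elim (σ-fixfree Px σx≡x)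
      ... | there σx∈xs = σx∈xs

      remove-partner-closed : ∀ {x xs} → P x → All P xs → All (x ≢_) xs → Closed σ (x ∷ xs) →
                              Closed σ (remove (σ x) xs)
      remove-partner-closed {x} {xs} Px Pxs x∉xs closed y∈L′ with ∈-filter⁻ (λ y → ¬? (y ≟ σ x)) y∈L′
      ... | y∈xs , y≢σx with closed (there y∈xs)
      ...   | here σy≡x = ⊥-elim (y≢σx (trans (sym (σ-involutive (All.lookup Pxs y∈xs))) (cong σ σy≡x)))
      ...   | there σy∈xs = ∈-filter⁺ (λ y → ¬? (y ≟ σ x)) σy∈xs
                              (λ σy≡σx → All.lookup x∉xs y∈xs (sym (σ-injective (All.lookup Pxs y∈xs) Px σy≡σx)))

      transversal-isTransversal : ∀ fuel L → length L ≤ fuel → Unique L → All P L → Closed σ L →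
                                  IsTransversal σ (transversal fuel L) L
      transversal-isTransversal zero [] _ _ _ _ = record { length-half = refl ; covers = λ () ; sub = λ () }
      transversal-isTransversal (suc fuel) [] _ _ _ _ = record { length-half = refl ; covers = λ () ; sub = λ () }
      transversal-isTransversal (suc fuel) (x ∷ xs) (s≤s |xs|≤fuel) (x∉xs ∷ xs-unique) (Px ∷ Pxs) closed =
        record { length-half = length-half′ ; covers = covers′ ; sub = sub′ }
        where
        L′ = remove (σ x) xs
        T′ = transversal fuel L′
        |L′|+1≡|xs| : suc (length L′) ≡ length xs
        |L′|+1≡|xs| = length-remove xs-unique (partner∈ Px closed)
        IH : IsTransversal σ T′ L′
        IH = transversal-isTransversal fuel L′ (ℕ.≤-trans (ℕ.≤-trans (ℕ.n≤1+n _) (ℕ.≤-reflexive |L′|+1≡|xs|)) |xs|≤fuel)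
               (Unique.filter⁺ (λ y → ¬? (y ≟ σ x)) xs-unique)
               (All.tabulate (λ y∈L′ → All.lookup Pxs (proj₁ (∈-filter⁻ (λ y → ¬? (y ≟ σ x)) y∈L′))))
               (remove-partner-closed Px Pxs x∉xs closed)
        open IsTransversal IH
        length-half′ : suc (length xs) ≡ suc (length T′ + suc (length T′))
        length-half′ = cong suc (trans (sym |L′|+1≡|xs|) (trans (cong suc length-half) (sym (ℕ.+-suc _ _))))
        covers′ : ∀ {y} → y ∈ x ∷ xs → ∃ λ t → t ∈ x ∷ T′ × (y ≡ t ⊎ y ≡ σ t)
        covers′ (here refl) = x , here refl , inj₁ refl
        covers′ {y} (there y∈xs) with y ≟ σ x
        ... | yes refl = x , here refl , inj₂ refl
        ... | no y≢σx with covers (∈-filter⁺ (λ y → ¬? (y ≟ σ x)) y∈xs y≢σx)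
        ...   | t , t∈T′ , y≡t∨σt = t , there t∈T′ , y≡t∨σt
        sub′ : ∀ {t} → t ∈ x ∷ T′ → t ∈ x ∷ xs
        sub′ (here t≡x) = here t≡x
        sub′ (there t∈T′) = there (proj₁ (∈-filter⁻ (λ y → ¬? (y ≟ σ x)) (sub t∈T′)))

module Representatives where

  open import Data.Integer as ℤ using (ℤ; +_; _+_; _*_; _-_; -_; 1ℤ)
  open import Data.Integer.Divisibility.Signed
  import Data.Integer.Properties as ℤ
  open import Data.Integer.Tactic.RingSolver using (solve-∀)
  open import Data.Nat as ℕ using (ℕ; suc; _≟_; z≤n; s≤s)
  import Data.Nat.Properties as ℕ
  open import Data.Nat.Primality using (Prime)
  open import Data.List using (List; length; applyUpTo)
  open import Data.List.Properties using (length-applyUpTo)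
  open import Data.List.Membership.Propositional using (_∈_)
  open import Data.List.Membership.Propositional.Properties using (∈-applyUpTo⁺; ∈-applyUpTo⁻)
  import Data.List.Relation.Unary.Unique.Propositional.Properties as Unique
  import Data.List.Relation.Unary.All as All
  open import Data.Product using (_×_; _,_; ∃; proj₁; proj₂; map₂)
  open import Data.Sum as Sum using (_⊎_; inj₁; inj₂)
  open import Function using (_∘_)
  open import Relation.Nullary using (¬_)
  open import Relation.Binary.PropositionalEquality

  open Congruence
  open PrimeModulus
  open TwoNonResidue
  open HalfSystem
  open Transversal

  module Orbits {q : ℕ} (q-prime : Prime q) (t : ℕ) (q≡8t+5 : q ≡ 8 ℕ.* t ℕ.+ 5) where

    open FiveModEight q-prime t q≡8t+5

    private
      m : ℕ
      m = h ℕ.+ h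

      q≡2m+1 : q ≡ suc (m ℕ.+ m)
      q≡2m+1 = q≡4h+1

      Half : ℕ → Set
      Half = InHalf m

      σ : ℕ → ℕ
      σ u = rep m q≡2m+1 (√-1 * + u)

      q∤Half : ∀ {u} → Half u → ¬ (+ q ∣ + u)
      q∤Half = n∤InHalf m q≡2m+1

      σ-≈± : ∀ u → + σ u ≈± √-1 * + u [mod + q ]
      σ-≈± u = rep-≈± m q≡2m+1 (√-1 * + u)

      σ-Half : ∀ {u} → Half u → Half (σ u)
      σ-Half Hu = rep-InHalf m q≡2m+1 _ (prime∤* q-prime (q∤√-1) (q∤Half Hu))

      σ-involutive : ∀ {u} → Half u → σ (σ u) ≡ u
      σ-involutive {u} Hu = InHalf-≈±-injective m q≡2m+1 (σ-Half (σ-Half Hu)) Hu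
        (≈±-trans (σ-≈± (σ u)) (≈±-trans (≈±-*-congˡ √-1 (σ-≈± u)) (inj₂ √-1²u≈-u)))
        where
        lemma : ∀ i u → i * (i * u) ≡ (i * i) * u
        lemma = solve-∀
        √-1²u≈-u : √-1 * (√-1 * + u) ≈ - + u [mod + q ]
        √-1²u≈-u = ≈-trans (≈-reflexive (lemma √-1 (+ u)))
                   (≈-trans (*-congʳ (+ u) (√-1²≈-1)) (≈-reflexive (ℤ.-1*i≡-i (+ u))))

      σ-fixfree : ∀ {u} → Half u → σ u ≢ u
      σ-fixfree {u} Hu σu≡u = ≉±√-1* (q∤Half Hu) (subst (λ v → + v ≈± √-1 * + u [mod + q ]) σu≡u (σ-≈± u))

      halves : List ℕ
      halves = applyUpTo suc m

      ∈halves⁻ : ∀ {u} → u ∈ halves → Half u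
      ∈halves⁻ u∈ with ∈-applyUpTo⁻ suc u∈
      ... | j , j<m , refl = s≤s z≤n , j<m

      ∈halves⁺ : ∀ {u} → Half u → u ∈ halves
      ∈halves⁺ {suc u} (_ , u<m) = ∈-applyUpTo⁺ suc u<m

      halves-transversal : IsTransversal σ (transversal _≟_ σ m halves) halves
      halves-transversal = transversal-isTransversal _≟_ σ Half σ-Half σ-involutive σ-fixfree m halves
        (ℕ.≤-reflexive (length-applyUpTo suc m))
        (Unique.applyUpTo⁺₁ suc m (λ i<j _ eq → ℕ.<⇒≢ i<j (ℕ.suc-injective eq)))
        (All.tabulate ∈halves⁻) (λ u∈ → ∈halves⁺ (σ-Half (∈halves⁻ u∈)))

    private
      double-injective : ∀ a b → a ℕ.+ a ≡ b ℕ.+ b → a ≡ b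
      double-injective a b a+a≡b+b = ℕ.*-cancelˡ-≡ a b 2 (trans (cong (a ℕ.+_) (ℕ.+-identityʳ a))
                                       (trans a+a≡b+b (cong (b ℕ.+_) (sym (ℕ.+-identityʳ b)))))

    opaque
      representatives : List ℕ
      representatives = transversal _≟_ σ m halves

      length-representatives : length representatives ≡ h
      length-representatives = double-injective _ h (trans (sym length-half) (length-applyUpTo suc m))
        where open IsTransversal halves-transversal

      representative-InHalf : ∀ {u} → u ∈ representatives → InHalf m u
      representative-InHalf u∈ = ∈halves⁻ (sub u∈)
        where open IsTransversal halves-transversal

      representatives-cover : ∀ y → ¬ (+ q ∣ y) →
        ∃ λ u → u ∈ representatives × (y ≈± + u [mod + q ] ⊎ y ≈± √-1 * + u [mod + q ])
      representatives-cover y q∤y =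
        from-orbit (IsTransversal.covers halves-transversal (∈halves⁺ (rep-InHalf m q≡2m+1 y q∤y)))
        where
        rep-y≈±y : + rep m q≡2m+1 y ≈± y [mod + q ]
        rep-y≈±y = rep-≈± m q≡2m+1 y
        from-orbit : (∃ λ u → u ∈ representatives × (rep m q≡2m+1 y ≡ u ⊎ rep m q≡2m+1 y ≡ σ u)) →
                     ∃ λ u → u ∈ representatives × (y ≈± + u [mod + q ] ⊎ y ≈± √-1 * + u [mod + q ])
        from-orbit (u , u∈ , inj₁ refl) = u , u∈ , inj₁ (≈±-sym rep-y≈±y)
        from-orbit (u , u∈ , inj₂ rep≡σu) =
          u , u∈ , inj₂ (≈±-trans (≈±-sym rep-y≈±y) (subst (λ v → + v ≈± √-1 * + u [mod + q ]) (sym rep≡σu) (σ-≈± u)))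

    q∤representative : ∀ {u} → u ∈ representatives → ¬ (+ q ∣ + u)
    q∤representative u∈ = q∤Half (representative-InHalf u∈)

    representatives-cover-scaled : ∀ μ ν → ¬ (+ q ∣ μ) → ν ≈± μ * √-1 [mod + q ] → ∀ y → ¬ (+ q ∣ y) →
      ∃ λ u → u ∈ representatives × (y ≈± μ * + u [mod + q ] ⊎ y ≈± ν * + u [mod + q ])
    representatives-cover-scaled μ ν q∤μ ν≈±μi y q∤y =
      map₂ (λ {u} → map₂ (Sum.map (≈±-trans y≈±μ[μ⁻¹y] ∘ ≈±-*-congˡ μ) (rescale u)))
           (representatives-cover (μ⁻¹ * y) (prime∤* q-prime q∤μ⁻¹ q∤y))
      where
      μ⁻¹ : ℤ
      μ⁻¹ = proj₁ (inverse q-prime μ q∤μ)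
      μμ⁻¹≈1 : μ * μ⁻¹ ≈ 1ℤ [mod + q ]
      μμ⁻¹≈1 = proj₂ (inverse q-prime μ q∤μ)
      q∤μ⁻¹ : ¬ (+ q ∣ μ⁻¹)
      q∤μ⁻¹ q∣μ⁻¹ = prime∤1 q-prime (∣-respʳ-≈ μμ⁻¹≈1 (∣n⇒∣m*n μ q∣μ⁻¹))
      y≈±μ[μ⁻¹y] : y ≈± μ * (μ⁻¹ * y) [mod + q ]
      y≈±μ[μ⁻¹y] = inj₁ (≈-sym (≈-trans (≈-reflexive (sym (ℤ.*-assoc μ μ⁻¹ y)))
                                        (≈-trans (*-congʳ y μμ⁻¹≈1) (≈-reflexive (ℤ.*-identityˡ y)))))
      rescale : ∀ u → μ⁻¹ * y ≈± √-1 * + u [mod + q ] → y ≈± ν * + u [mod + q ]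
      rescale u μ⁻¹y≈±iu = ≈±-trans y≈±μ[μ⁻¹y] (≈±-trans (≈±-*-congˡ μ μ⁻¹y≈±iu)
        (≈±-trans (inj₁ (≈-reflexive (sym (ℤ.*-assoc μ √-1 (+ u))))) (≈±-sym (≈±-*-congʳ (+ u) ν≈±μi))))

module APSConditions where

  open import Defs
  open import Data.Integer as ℤ using (ℤ; +_; -[1+_]; _+_; _*_; _-_; -_; 0ℤ)
  open import Data.Integer.Divisibility.Signed
  open import Data.Integer.DivMod using (n%ℕd<d)
  import Data.Integer.Properties as ℤ
  open import Data.Integer.Tactic.RingSolver using (solve-∀)
  open import Data.Nat as ℕ using (ℕ; suc; _∸_)
  open import Data.Nat.DivMod using (_/_)
  open import Data.Fin using (Fin; toℕ; fromℕ<)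
  open import Data.Fin.Properties using (toℕ-fromℕ<)
  open import Data.List using (List; length)
  open import Data.List.Relation.Unary.Any as Any using (Any)
  open import Data.Product using (_×_; _,_; ∃)
  open import Data.Sum as Sum using (_⊎_; inj₁; inj₂)
  open import Function using (_∘_; _⇔_; mk⇔; Equivalence)
  import Function.Properties.Equivalence as ⇔
  open import Relation.Nullary using (¬_)
  open import Relation.Binary.PropositionalEquality

  open Congruence

  module _ {n : ℕ} where

    private
      +[a+k*n]≈a : ∀ a k → + (a ℕ.+ k ℕ.* n) ≈ + a [mod + n ]
      +[a+k*n]≈a a k = congruent (divides (+ k) (begin
        + (a ℕ.+ k ℕ.* n) - + a      ≡⟨ cong (_- + a) (trans (ℤ.pos-+ a (k ℕ.* n)) (cong (_+_ (+ a)) (ℤ.pos-* k n))) ⟩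
        + a + + k * + n - + a        ≡⟨ lemma (+ a) (+ k) (+ n) ⟩
        + k * + n                    ∎))
        where
        open ≡-Reasoning
        lemma : ∀ a k n → a + k * n - a ≡ k * n
        lemma = solve-∀

    ≡[mod]⇒≈ : ∀ {a b} → a ≡ b [mod n ] → + a ≈ + b [mod + n ]
    ≡[mod]⇒≈ {a} (k , inj₁ a+kn≡b) = ≈-sym (subst (λ x → + x ≈ + a [mod + n ]) a+kn≡b (+[a+k*n]≈a a k))
    ≡[mod]⇒≈ {b = b} (k , inj₂ b+kn≡a) = subst (λ x → + x ≈ + b [mod + n ]) b+kn≡a (+[a+k*n]≈a b k)

    ≈⇒≡[mod] : ∀ {a b} → + a ≈ + b [mod + n ] → a ≡ b [mod n ]
    ≈⇒≡[mod] {a} {b} (congruent (divides (+ k) a-b≡kn)) = k , inj₂ (ℤ.+-injective (begin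
      + (b ℕ.+ k ℕ.* n)      ≡⟨ trans (ℤ.pos-+ b (k ℕ.* n)) (cong (_+_ (+ b)) (ℤ.pos-* k n)) ⟩
      + b + + k * + n        ≡⟨ cong (_+_ (+ b)) a-b≡kn ⟨
      + b + (+ a - + b)      ≡⟨ lemma (+ a) (+ b) ⟩
      + a                    ∎))
      where
      open ≡-Reasoning
      lemma : ∀ a b → b + (a - b) ≡ a
      lemma = solve-∀
    ≈⇒≡[mod] {a} {b} (congruent (divides -[1+ k ] a-b≡-kn)) = suc k , inj₁ (ℤ.+-injective (begin
      + (a ℕ.+ suc k ℕ.* n)         ≡⟨ trans (ℤ.pos-+ a (suc k ℕ.* n)) (cong (_+_ (+ a)) (ℤ.pos-* (suc k) n)) ⟩
      + a + + suc k * + n           ≡⟨ cong (_+_ (+ a)) (ℤ.neg-distribˡ-* -[1+ k ] (+ n)) ⟨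
      + a + - (-[1+ k ] * + n)      ≡⟨ cong (λ x → + a + - x) a-b≡-kn ⟨
      + a + - (+ a - + b)           ≡⟨ lemma (+ a) (+ b) ⟩
      + b                           ∎))
      where
      open ≡-Reasoning
      lemma : ∀ a b → a + - (a - b) ≡ b
      lemma = solve-∀

    ∈±⇒≈± : ∀ {a b} → a ∈± b [mod n ] → + a ≈± + b [mod + n ]
    ∈±⇒≈± (inj₁ a≡b) = inj₁ (≡[mod]⇒≈ a≡b)
    ∈±⇒≈± {a} {b} (inj₂ a+b≡0) = inj₂ (≈-trans (+≈⇒≈- {a = + a} {+ b} (subst (λ x → x ≈ 0ℤ [mod + n ]) (ℤ.pos-+ a b) (≡[mod]⇒≈ a+b≡0)))
                                      (≈-reflexive (ℤ.+-identityˡ (- + b))))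

    ≈±⇒∈± : ∀ {a b} → + a ≈± + b [mod + n ] → a ∈± b [mod n ]
    ≈±⇒∈± (inj₁ a≈b) = inj₁ (≈⇒≡[mod] a≈b)
    ≈±⇒∈± {a} {b} (inj₂ a≈-b) = inj₂ (≈⇒≡[mod] (subst (λ x → x ≈ 0ℤ [mod + n ]) (sym (ℤ.pos-+ a b)) (≈-⇒+≈ {a = + a} {+ b} (≈-trans a≈-b (≈-reflexive (sym (ℤ.+-identityˡ (- + b))))))))

    ∈±diff⇒≈± : ∀ {z x y} → z ∈±diff x , y [mod n ] → + z ≈± + x - + y [mod + n ]
    ∈±diff⇒≈± {z} {x} {y} (inj₁ z+y≡x) = inj₁ (+≈⇒≈- {a = + z} {+ y} (subst (λ w → w ≈ + x [mod + n ]) (ℤ.pos-+ z y) (≡[mod]⇒≈ z+y≡x)))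
    ∈±diff⇒≈± {z} {x} {y} (inj₂ z+x≡y) =
      inj₂ (≈-trans (+≈⇒≈- {a = + z} {+ x} (subst (λ w → w ≈ + y [mod + n ]) (ℤ.pos-+ z x) (≡[mod]⇒≈ z+x≡y))) (≈-reflexive (lemma (+ x) (+ y))))
      where
      lemma : ∀ x y → y - x ≡ - (x - y)
      lemma = solve-∀

    ≈±⇒∈±diff : ∀ {z x y} → + z ≈± + x - + y [mod + n ] → z ∈±diff x , y [mod n ]
    ≈±⇒∈±diff {z} {x} {y} (inj₁ z≈x-y) = inj₁ (≈⇒≡[mod] (subst (λ w → w ≈ + x [mod + n ]) (sym (ℤ.pos-+ z y)) (≈-⇒+≈ {a = + z} {+ y} z≈x-y)))
    ≈±⇒∈±diff {z} {x} {y} (inj₂ z≈-[x-y]) =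
      inj₂ (≈⇒≡[mod] (subst (λ w → w ≈ + y [mod + n ]) (sym (ℤ.pos-+ z x)) (≈-⇒+≈ {a = + z} {+ x} (≈-trans z≈-[x-y] (≈-reflexive (lemma (+ x) (+ y)))))))
      where
      lemma : ∀ x y → - (x - y) ≡ y - x
      lemma = solve-∀

  module _ {n : ℕ} where

    private
      2a²↑ : ∀ a → + (2 ℕ.* (a ℕ.* a)) ≡ + 2 * (+ a * + a)
      2a²↑ a = trans (ℤ.pos-* 2 (a ℕ.* a)) (cong (_*_ (+ 2)) (ℤ.pos-* a a))

    2a²≡b²⇒≈ : ∀ a b → (2 ℕ.* (a ℕ.* a)) ≡ (b ℕ.* b) [mod n ] → + 2 * (+ a * + a) ≈ + b * + b [mod + n ]
    2a²≡b²⇒≈ a b 2a²≡b² = subst₂ (_≈_[mod + n ]) (2a²↑ a) (ℤ.pos-* b b) (≡[mod]⇒≈ 2a²≡b²)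

    ≈⇒2a²≡b² : ∀ a b → + 2 * (+ a * + a) ≈ + b * + b [mod + n ] → (2 ℕ.* (a ℕ.* a)) ≡ (b ℕ.* b) [mod n ]
    ≈⇒2a²≡b² a b 2a²≈b² = ≈⇒≡[mod] (subst₂ (_≈_[mod + n ]) (sym (2a²↑ a)) (sym (ℤ.pos-* b b)) 2a²≈b²)

  ⌊_⌋ : ∀ {n} → Fin n → ℤ
  ⌊ x ⌋ = + toℕ x

  infix 4 _∈±ᵖ_[mod_]

  _∈±ᵖ_[mod_] : ℤ → ℤ × ℤ → ℤ → Set
  z ∈±ᵖ (a , b) [mod m ] = z ≈± a [mod m ] ⊎ z ≈± b [mod m ]

  Avoids : ℤ → ℤ → ℤ → Set
  Avoids m z g = ¬ (z ≈ 0ℤ [mod m ]) × ¬ (z ≈± g [mod m ])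

  infix 4 _≋±_[mod_]

  _≋±_[mod_] : ℤ × ℤ → ℤ × ℤ → ℤ → Set
  (a , b) ≋± (a′ , b′) [mod m ] = a ≈± a′ [mod m ] × b ≈± b′ [mod m ]

  ∈±ᵖ-resp-≋± : ∀ {m z v w} → z ∈±ᵖ v [mod m ] → v ≋± w [mod m ] → z ∈±ᵖ w [mod m ]
  ∈±ᵖ-resp-≋± (inj₁ z≈±a) (a≈±a′ , _) = inj₁ (≈±-trans z≈±a a≈±a′)
  ∈±ᵖ-resp-≋± (inj₂ z≈±b) (_ , b≈±b′) = inj₂ (≈±-trans z≈±b b≈±b′)

  ≋±-sym : ∀ {m v w} → v ≋± w [mod m ] → w ≋± v [mod m ]
  ≋±-sym (a≈±a′ , b≈±b′) = ≈±-sym a≈±a′ , ≈±-sym b≈±b′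

  values diffSum : ∀ {n} → Pair n → ℤ × ℤ
  values (x , y) = ⌊ x ⌋ , ⌊ y ⌋
  diffSum (x , y) = ⌊ x ⌋ - ⌊ y ⌋ , ⌊ x ⌋ + ⌊ y ⌋

  -- A condition of an APS read in ℤ, where f reads a pair either as {x, y} or as {x - y, x + y}.
  Covers : (n : ℕ) → List (Pair n) → (Pair n → ℤ × ℤ) → ℤ → Set
  Covers n S f g = ∀ (z : Fin n) → Any (λ pr → ⌊ z ⌋ ∈±ᵖ f pr [mod + n ]) S ⇔ Avoids (+ n) ⌊ z ⌋ g

  module _ {n : ℕ} where

    InPM⇔ : ∀ z pr → InPM n z pr ⇔ ⌊ z ⌋ ∈±ᵖ values pr [mod + n ]
    InPM⇔ z (x , y) = mk⇔ (Sum.map ∈±⇒≈± ∈±⇒≈±) (Sum.map ≈±⇒∈± ≈±⇒∈±)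

    InPMDS⇔ : ∀ z pr → InPMDS n z pr ⇔ ⌊ z ⌋ ∈±ᵖ diffSum pr [mod + n ]
    InPMDS⇔ z (x , y) = mk⇔
      (Sum.map ∈±diff⇒≈± (subst (λ s → ⌊ z ⌋ ≈± s [mod + n ]) (ℤ.pos-+ (toℕ x) (toℕ y)) ∘ ∈±⇒≈±))
      (Sum.map ≈±⇒∈±diff (≈±⇒∈± ∘ subst (λ s → ⌊ z ⌋ ≈± s [mod + n ]) (sym (ℤ.pos-+ (toℕ x) (toℕ y)))))

    Avoids⇔ : ∀ (z g : Fin n) →
      (¬ (toℕ z ≡ 0 [mod n ]) × ¬ (toℕ z ∈± toℕ g [mod n ])) ⇔ Avoids (+ n) ⌊ z ⌋ ⌊ g ⌋
    Avoids⇔ z g = mk⇔ (λ (z≢0 , z∉±g) → z≢0 ∘ ≈⇒≡[mod] , z∉±g ∘ ≈±⇒∈±)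
                      (λ (z≉0 , z≉±g) → z≉0 ∘ ≡[mod]⇒≈ , z≉±g ∘ ∈±⇒≈±)

  private
    Any-map⇔ : ∀ {A : Set} {P Q : A → Set} {xs} → (∀ x → P x ⇔ Q x) → Any P xs ⇔ Any Q xs
    Any-map⇔ P⇔Q = mk⇔ (Any.map (Equivalence.to (P⇔Q _))) (Any.map (Equivalence.from (P⇔Q _)))

  APS⇒Covers : ∀ {n α β} → APS n α β →
    ∃ λ S → length S ≡ (n ∸ 3) / 4 × Covers n S values ⌊ α ⌋ × Covers n S diffSum ⌊ β ⌋
  APS⇒Covers {α = α} {β} (S , |S| , cover₁ , cover₂) =
    S , |S| , (λ z → ⇔.trans (⇔.sym (Any-map⇔ (InPM⇔ z))) (⇔.trans (cover₁ z) (Avoids⇔ z α)))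
            , (λ z → ⇔.trans (⇔.sym (Any-map⇔ (InPMDS⇔ z))) (⇔.trans (cover₂ z) (Avoids⇔ z β)))

  Covers⇒APS : ∀ {n α β} (S : List (Pair n)) → length S ≡ (n ∸ 3) / 4 →
    Covers n S values ⌊ α ⌋ → Covers n S diffSum ⌊ β ⌋ → APS n α β
  Covers⇒APS {α = α} {β} S |S| cover₁ cover₂ =
    S , |S| , (λ z → ⇔.trans (Any-map⇔ (InPM⇔ z)) (⇔.trans (cover₁ z) (⇔.sym (Avoids⇔ z α))))
            , (λ z → ⇔.trans (Any-map⇔ (InPMDS⇔ z)) (⇔.trans (cover₂ z) (⇔.sym (Avoids⇔ z β))))

  reduce : (m : ℕ) .{{_ : ℕ.NonZero m}} → ℤ → Fin m
  reduce m x = fromℕ< (n%ℕd<d x m)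

  ⌊reduce⌋≈ : ∀ m .{{_ : ℕ.NonZero m}} x → ⌊ reduce m x ⌋ ≈ x [mod + m ]
  ⌊reduce⌋≈ m x = subst (λ r → + r ≈ x [mod + m ]) (sym (toℕ-fromℕ< (n%ℕd<d x m))) (≈-sym (x≈x%ℕn x m))

module Lifting where

  open import Defs using (Pair; APS)
  open import Data.Integer as ℤ using (ℤ; +_; _+_; _*_; _-_; -_; 1ℤ)
  open import Data.Integer.Divisibility.Signed
  import Data.Integer.Properties as ℤ
  open import Data.Integer.Tactic.RingSolver using (solve-∀)
  open import Data.Nat as ℕ using (ℕ; _∸_)
  open import Data.Nat.DivMod using (_/_)
  import Data.Nat.Properties as ℕ
  import Data.Nat.Divisibility as ℕ
  open import Data.Nat.Primality using (Prime; prime⇒nonZero)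
  open import Data.Fin using (Fin; toℕ; fromℕ<)
  open import Data.Fin.Properties using (toℕ-fromℕ<; toℕ<n)
  open import Data.List using (List; []; _∷_; length; map; _++_; concatMap; tabulate)
  open import Data.List.Properties using (length-++; length-map; length-tabulate)
  open import Data.List.Relation.Unary.Any as Any using (Any)
  import Data.List.Relation.Unary.Any.Properties as Any
  open import Data.List.Membership.Propositional using (_∈_; find; lose)
  open import Data.Product using (_×_; _,_; ∃; proj₁; proj₂; map₂)
  open import Data.Sum as Sum using (_⊎_; inj₁; inj₂; [_,_]′)
  open import Function using (_∘_; _⇔_; mk⇔; Equivalence)
  open import Relation.Nullary using (¬_)
  open import Relation.Nullary.Decidable using (toSum)
  open import Relation.Binary.PropositionalEquality

  open Congruence
  open PrimeModulus
  open TwoNonResidue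
  open Representatives
  open APSConditions

  module Construction {p q : ℕ} (p-prime : Prime p) (q-prime : Prime q) (p≢q : p ≢ q)
              (p∤2 : ¬ (+ p ∣ + 2)) (p∤3 : ¬ (+ p ∣ + 3))
              (t : ℕ) (q≡8t+5 : q ≡ 8 ℕ.* t ℕ.+ 5) where

    open FiveModEight q-prime t q≡8t+5
    open Orbits q-prime t q≡8t+5

    n : ℕ
    n = p ℕ.* q

    instance
      p≢0 : ℕ.NonZero p
      p≢0 = prime⇒nonZero p-prime
      q≢0 : ℕ.NonZero q
      q≢0 = prime⇒nonZero q-prime
      n≢0 : ℕ.NonZero n
      n≢0 = ℕ.m*n≢0 p q

    q*p≡n : + q * + p ≡ + n
    q*p≡n = trans (ℤ.*-comm (+ q) (+ p)) (sym (ℤ.pos-* p q))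

    q*[a-b] : ∀ q a b → q * (a - b) ≡ q * a - q * b
    q*[a-b] = solve-∀

    ≈-scale : ∀ {a b} → a ≈ b [mod + p ] → + q * a ≈ + q * b [mod + n ]
    ≈-scale {a} {b} (congruent p∣a-b) =
      congruent (subst₂ _∣_ q*p≡n (q*[a-b] (+ q) a b) (*-monoʳ-∣ (+ q) p∣a-b))

    ≈-unscale : ∀ {a b} → + q * a ≈ + q * b [mod + n ] → a ≈ b [mod + p ]
    ≈-unscale {a} {b} (congruent n∣qa-qb) =
      congruent (*-cancelˡ-∣ (+ q) (subst₂ _∣_ (sym q*p≡n) (sym (q*[a-b] (+ q) a b)) n∣qa-qb))

    ≈±-scale : ∀ {a b} → a ≈± b [mod + p ] → + q * a ≈± + q * b [mod + n ]
    ≈±-scale (inj₁ a≈b) = inj₁ (≈-scale a≈b)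
    ≈±-scale {b = b} (inj₂ a≈-b) = inj₂ (≈-trans (≈-scale a≈-b) (≈-reflexive (sym (ℤ.neg-distribʳ-* (+ q) b))))

    ≈±-unscale : ∀ {a b} → + q * a ≈± + q * b [mod + n ] → a ≈± b [mod + p ]
    ≈±-unscale (inj₁ qa≈qb) = inj₁ (≈-unscale qa≈qb)
    ≈±-unscale {b = b} (inj₂ qa≈-qb) = inj₂ (≈-unscale (≈-trans qa≈-qb (≈-reflexive (ℤ.neg-distribʳ-* (+ q) b))))

    scaleᵖ : ℤ × ℤ → ℤ × ℤ
    scaleᵖ (a , b) = + q * a , + q * b

    ∈±ᵖ-scale⇔ : ∀ w v → + q * w ∈±ᵖ scaleᵖ v [mod + n ] ⇔ w ∈±ᵖ v [mod + p ]
    ∈±ᵖ-scale⇔ w (a , b) = mk⇔ (Sum.map ≈±-unscale ≈±-unscale) (Sum.map ≈±-scale ≈±-scale)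

    q∣n : + q ∣ + n
    q∣n = divides (+ p) (ℤ.pos-* p q)

    q∣q* : ∀ a → + q ∣ + q * a
    q∣q* a = divides a (ℤ.*-comm (+ q) a)

    ∈±ᵖ-scale⇒q∣ : ∀ {z v} → z ∈±ᵖ scaleᵖ v [mod + n ] → + q ∣ z
    ∈±ᵖ-scale⇒q∣ {v = a , b} (inj₁ z≈±qa) = ∣-resp-≈± (≈±-weaken q∣n z≈±qa) (q∣q* a)
    ∈±ᵖ-scale⇒q∣ {v = a , b} (inj₂ z≈±qb) = ∣-resp-≈± (≈±-weaken q∣n z≈±qb) (q∣q* b)

    Avoids-scale⇔ : ∀ w g → Avoids (+ n) (+ q * w) (+ q * g) ⇔ Avoids (+ p) w g
    Avoids-scale⇔ w g = mk⇔
      (λ (qw≉0 , qw≉±qg) → (λ w≈0 → qw≉0 (≈-trans (≈-scale w≈0) (≈-reflexive (ℤ.*-zeroʳ (+ q))))) , qw≉±qg ∘ ≈±-scale)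
      (λ (w≉0 , w≉±g) → (λ qw≈0 → w≉0 (≈-unscale (≈-trans qw≈0 (≈-reflexive (sym (ℤ.*-zeroʳ (+ q))))))) , w≉±g ∘ ≈±-unscale)

    q∤⇒Avoids : ∀ {z} g → ¬ (+ q ∣ z) → Avoids (+ n) z (+ q * g)
    q∤⇒Avoids g q∤z = (λ z≈0 → q∤z (≈0⇒∣ (≈-weaken q∣n z≈0)))
                    , (λ z≈±qg → q∤z (∣-resp-≈± (≈±-weaken q∣n z≈±qg) (q∣q* g)))

    divide-by-q : (z : Fin n) → + q ∣ ⌊ z ⌋ → ∃ λ (w : Fin p) → ⌊ z ⌋ ≡ + q * ⌊ w ⌋
    divide-by-q z q∣z with ∣⇒∣ᵤ q∣z
    ... | ℕ.divides k z≡kq = fromℕ< k<p , (begin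
      + toℕ z                        ≡⟨ cong +_ z≡kq ⟩
      + (k ℕ.* q)                    ≡⟨ ℤ.pos-* k q ⟩
      + k * + q                      ≡⟨ ℤ.*-comm (+ k) (+ q) ⟩
      + q * + k                      ≡⟨ cong (λ j → + q * + j) (toℕ-fromℕ< k<p) ⟨
      + q * + toℕ (fromℕ< k<p)       ∎)
      where
      open ≡-Reasoning
      k<p : k ℕ.< p
      k<p = ℕ.*-cancelʳ-< q k p (subst (ℕ._< n) z≡kq (toℕ<n z))

    embed : Pair p → Pair n
    embed (x , y) = reduce n (+ q * ⌊ x ⌋) , reduce n (+ q * ⌊ y ⌋)

    values-embed : ∀ pr → values (embed pr) ≋± scaleᵖ (values pr) [mod + n ]
    values-embed (x , y) = inj₁ (⌊reduce⌋≈ n (+ q * ⌊ x ⌋)) , inj₁ (⌊reduce⌋≈ n (+ q * ⌊ y ⌋))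

    diffSum-embed : ∀ pr → diffSum (embed pr) ≋± scaleᵖ (diffSum pr) [mod + n ]
    diffSum-embed (x , y) =
        inj₁ (≈-trans (+-cong (⌊reduce⌋≈ n (+ q * ⌊ x ⌋)) (-‿cong (⌊reduce⌋≈ n (+ q * ⌊ y ⌋))))
                      (≈-reflexive (sym (q*[a-b] (+ q) ⌊ x ⌋ ⌊ y ⌋))))
      , inj₁ (≈-trans (+-cong (⌊reduce⌋≈ n (+ q * ⌊ x ⌋)) (⌊reduce⌋≈ n (+ q * ⌊ y ⌋)))
                      (≈-reflexive (sym (ℤ.*-distribˡ-+ (+ q) ⌊ x ⌋ ⌊ y ⌋))))

    record Multiplier : Set where
      field
        M μ : ℤ
        p∤M : ¬ (+ p ∣ M)
        M≈μ : M ≈ μ [mod + q ]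
        q∤μ : ¬ (+ q ∣ μ)

    open Multiplier

    c : ℤ
    c = proj₁ (crt p-prime q-prime p≢q (+ 2) √-1)

    c≈2 : c ≈ + 2 [mod + p ]
    c≈2 = proj₁ (proj₂ (crt p-prime q-prime p≢q (+ 2) √-1))

    c≈√-1 : c ≈ √-1 [mod + q ]
    c≈√-1 = proj₂ (proj₂ (crt p-prime q-prime p≢q (+ 2) √-1))

    p∤-resp-≈ : ∀ {a b} → a ≈ b [mod + p ] → ¬ (+ p ∣ b) → ¬ (+ p ∣ a)
    p∤-resp-≈ a≈b p∤b p∣a = p∤b (∣-respʳ-≈ a≈b p∣a)

    1× c× [c-1]× [c+1]× : Multiplier
    1× = record { M = 1ℤ ; μ = 1ℤ ; p∤M = prime∤1 p-prime ; M≈μ = ≈-refl ; q∤μ = prime∤1 q-prime }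
    c× = record { M = c ; μ = √-1 ; p∤M = p∤-resp-≈ c≈2 p∤2 ; M≈μ = c≈√-1 ; q∤μ = q∤√-1 }
    [c-1]× = record
      { M = c - 1ℤ ; μ = √-1 - 1ℤ ; p∤M = p∤-resp-≈ (+-cong c≈2 (≈-refl {a = - 1ℤ})) (prime∤1 p-prime)
      ; M≈μ = +-cong c≈√-1 (≈-refl {a = - 1ℤ}) ; q∤μ = q∤√-1-1 }
    [c+1]× = record
      { M = c + 1ℤ ; μ = √-1 + 1ℤ ; p∤M = p∤-resp-≈ (+-cong c≈2 (≈-refl {a = 1ℤ})) p∤3
      ; M≈μ = +-cong c≈√-1 (≈-refl {a = 1ℤ}) ; q∤μ = q∤√-1+1 }

    lift : ℕ → Fin p → ℤ
    lift u k = + u + + q * ⌊ k ⌋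

    lift≈ : ∀ u k → lift u k ≈ + u [mod + q ]
    lift≈ u k = congruent (divides ⌊ k ⌋ (lemma (+ u) (+ q) ⌊ k ⌋))
      where
      lemma : ∀ u q k → u + q * k - u ≡ k * q
      lemma = solve-∀

    -- k is found modulo p by inverting M q; modulo q there is nothing to solve.
    reach≈ : ∀ U {z u} → z ≈ μ U * + u [mod + q ] → ∃ λ k → M U * lift u k ≈ z [mod + n ]
    reach≈ U {z} {u} z≈μu = k , ≈-combine p-prime q-prime p≢q mod-p mod-q
      where
      p∤q : ¬ (+ p ∣ + q)
      p∤q = q∤p q-prime p-prime (p≢q ∘ sym)
      v : ℤ
      v = proj₁ (inverse p-prime (M U * + q) (prime∤* p-prime (p∤M U) p∤q))
      Mqv≈1 : M U * + q * v ≈ 1ℤ [mod + p ]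
      Mqv≈1 = proj₂ (inverse p-prime (M U * + q) (prime∤* p-prime (p∤M U) p∤q))
      d : ℤ
      d = z - M U * + u
      k : Fin p
      k = reduce p (v * d)
      mod-p : M U * lift u k ≈ z [mod + p ]
      mod-p = begin
        M U * (+ u + + q * ⌊ k ⌋)        ≡⟨ lemma₁ (M U) (+ u) (+ q) ⌊ k ⌋ ⟩
        M U * + u + M U * + q * ⌊ k ⌋    ≈⟨ +-cong (≈-refl {a = M U * + u}) (*-congˡ (M U * + q) (⌊reduce⌋≈ p (v * d))) ⟩
        M U * + u + M U * + q * (v * d)  ≡⟨ lemma₂ (M U * + u) (M U * + q) v d ⟩
        M U * + u + M U * + q * v * d    ≈⟨ +-cong (≈-refl {a = M U * + u}) (*-congʳ d Mqv≈1) ⟩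
        M U * + u + 1ℤ * d               ≡⟨ lemma₃ (M U * + u) z ⟩
        z                                ∎
        where
        open ≈-Reasoning (+ p)
        lemma₁ : ∀ m u q k → m * (u + q * k) ≡ m * u + m * q * k
        lemma₁ = solve-∀
        lemma₂ : ∀ a b v d → a + b * (v * d) ≡ a + b * v * d
        lemma₂ = solve-∀
        lemma₃ : ∀ a z → a + 1ℤ * (z - a) ≡ z
        lemma₃ = solve-∀
      mod-q : M U * lift u k ≈ z [mod + q ]
      mod-q = ≈-trans (*-cong (M≈μ U) (lift≈ u k)) (≈-sym z≈μu)

    reach : ∀ U {z u} → z ≈± μ U * + u [mod + q ] → ∃ λ k → z ≈± M U * lift u k [mod + n ]
    reach U (inj₁ z≈μu) = map₂ (inj₁ ∘ ≈-sym) (reach≈ U z≈μu)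
    reach U {z} (inj₂ z≈-μu) =
      map₂ (λ ML≈-z → inj₂ (≈-trans (≈-reflexive (sym (ℤ.neg-involutive z))) (-‿cong (≈-sym ML≈-z))))
           (reach≈ U (≈-trans (-‿cong z≈-μu) (≈-reflexive (ℤ.neg-involutive _))))

    q∤-reached : ∀ U {z u} k → ¬ (+ q ∣ + u) → z ≈± M U * lift u k [mod + n ] → ¬ (+ q ∣ z)
    q∤-reached U {z} {u} k q∤u z≈±ML q∣z = prime∤* q-prime (q∤μ U) q∤u
      (∣-resp-≈± (≈±-sym (≈±-resp-≈ (≈±-weaken q∣n z≈±ML) (*-cong (M≈μ U) (lift≈ u k)))) q∣z)

    newPair : ℕ → Fin p → Pair n
    newPair u k = reduce n (lift u k) , reduce n (c * lift u k)

    values-newPair : ∀ u k → values (newPair u k) ≋± (M 1× * lift u k , M c× * lift u k) [mod + n ]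
    values-newPair u k = inj₁ (≈-trans (⌊reduce⌋≈ n (lift u k)) (≈-reflexive (sym (ℤ.*-identityˡ (lift u k)))))
                       , inj₁ (⌊reduce⌋≈ n (c * lift u k))

    diffSum-newPair : ∀ u k → diffSum (newPair u k) ≋± (M [c-1]× * lift u k , M [c+1]× * lift u k) [mod + n ]
    diffSum-newPair u k =
        inj₂ (≈-trans (+-cong (⌊reduce⌋≈ n L) (-‿cong (⌊reduce⌋≈ n (c * L)))) (≈-reflexive (lemma₁ c L)))
      , inj₁ (≈-trans (+-cong (⌊reduce⌋≈ n L) (⌊reduce⌋≈ n (c * L))) (≈-reflexive (lemma₂ c L)))
      where
      L : ℤ
      L = lift u k
      lemma₁ : ∀ c L → L - c * L ≡ - ((c - 1ℤ) * L)
      lemma₁ = solve-∀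
      lemma₂ : ∀ c L → L + c * L ≡ (c + 1ℤ) * L
      lemma₂ = solve-∀

    μc≈±μ1*√-1 : μ c× ≈± μ 1× * √-1 [mod + q ]
    μc≈±μ1*√-1 = inj₁ (≈-reflexive (sym (ℤ.*-identityˡ √-1)))

    μ[c+1]≈±μ[c-1]*√-1 : μ [c+1]× ≈± μ [c-1]× * √-1 [mod + q ]
    μ[c+1]≈±μ[c-1]*√-1 = inj₂ (begin
      √-1 + 1ℤ                        ≡⟨ lemma₁ √-1 ⟩
      - - 1ℤ + √-1                    ≈⟨ +-cong (-‿cong √-1²≈-1) (≈-refl {a = √-1}) ⟨
      - (√-1 * √-1) + √-1             ≡⟨ lemma₂ √-1 ⟩
      - ((√-1 - 1ℤ) * √-1)            ∎)
      where
      open ≈-Reasoning (+ q)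
      lemma₁ : ∀ i → i + 1ℤ ≡ - - 1ℤ + i
      lemma₁ = solve-∀
      lemma₂ : ∀ i → - (i * i) + i ≡ - ((i - 1ℤ) * i)
      lemma₂ = solve-∀

    newPairs : List (Pair n)
    newPairs = concatMap (λ u → tabulate (newPair u)) (representatives)

    length-newPairs : length newPairs ≡ h ℕ.* p
    length-newPairs = trans (length-concatMap (representatives))
                            (cong (ℕ._* p) (length-representatives))
      where
      length-concatMap : ∀ us → length (concatMap (λ u → tabulate (newPair u)) us) ≡ length us ℕ.* p
      length-concatMap [] = refl
      length-concatMap (u ∷ us) = trans (length-++ (tabulate (newPair u)))
                                        (cong₂ ℕ._+_ (length-tabulate (newPair u)) (length-concatMap us))

    lifted : List (Pair p) → List (Pair n)
    lifted Sp = map embed Sp ++ newPairs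

    length-lifted : ∀ Sp → length (lifted Sp) ≡ length Sp ℕ.+ h ℕ.* p
    length-lifted Sp = trans (length-++ (map embed Sp)) (cong₂ ℕ._+_ (length-map embed Sp) length-newPairs)

    -- The covering argument, uniform in how a pair is read (as {x, y} or as {x - y, x + y}):
    -- the embedded pairs cover the multiples of q, the new pairs cover the units mod q.
    module _ (f : ∀ {m} → Pair m → ℤ × ℤ)
             (f-embed : ∀ pr → f (embed pr) ≋± scaleᵖ (f pr) [mod + n ])
             (U V : Multiplier)
             (f-newPair : ∀ u k → f (newPair u k) ≋± (M U * lift u k , M V * lift u k) [mod + n ])
             (μV≈±μU√-1 : μ V ≈± μ U * √-1 [mod + q ]) where

      embed-hit⇔ : ∀ w pr → + q * w ∈±ᵖ f (embed pr) [mod + n ] ⇔ w ∈±ᵖ f pr [mod + p ]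
      embed-hit⇔ w pr = mk⇔
        (λ hit → Equivalence.to (∈±ᵖ-scale⇔ w (f pr)) (∈±ᵖ-resp-≋± hit (f-embed pr)))
        (λ hit → ∈±ᵖ-resp-≋± (Equivalence.from (∈±ᵖ-scale⇔ w (f pr)) hit) (≋±-sym (f-embed pr)))

      embed-hit⇒q∣ : ∀ {z} pr → z ∈±ᵖ f (embed pr) [mod + n ] → + q ∣ z
      embed-hit⇒q∣ pr hit = ∈±ᵖ-scale⇒q∣ (∈±ᵖ-resp-≋± hit (f-embed pr))

      newPairs-hit⇒q∤ : ∀ {z} → Any (λ pr → z ∈±ᵖ f pr [mod + n ]) newPairs → ¬ (+ q ∣ z)
      newPairs-hit⇒q∤ hits =
        let (u , u∈ , hits-u) = find (Any.concatMap⁻ (tabulate ∘ newPair) hits)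
            (k , hit) = Any.tabulate⁻ hits-u
        in [ q∤-reached U k (q∤representative u∈)
           , q∤-reached V k (q∤representative u∈)
           ]′ (∈±ᵖ-resp-≋± hit (f-newPair u k))

      q∤⇒newPairs-hit : ∀ {z} → ¬ (+ q ∣ z) → Any (λ pr → z ∈±ᵖ f pr [mod + n ]) newPairs
      q∤⇒newPairs-hit {z} q∤z =
        let (u , u∈ , z≈±) = representatives-cover-scaled (μ U) (μ V) (q∤μ U) μV≈±μU√-1 z q∤z
        in hit-newPair u∈ z≈±
        where
        hit-newPair : ∀ {u} → u ∈ representatives →
                      z ≈± μ U * + u [mod + q ] ⊎ z ≈± μ V * + u [mod + q ] →
                      Any (λ pr → z ∈±ᵖ f pr [mod + n ]) newPairs
        hit-newPair {u} u∈ (inj₁ z≈±μUu) =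
          let (k , z≈±ML) = reach U z≈±μUu
          in Any.concatMap⁺ (tabulate ∘ newPair)
               (lose u∈ (Any.tabulate⁺ k (∈±ᵖ-resp-≋± (inj₁ z≈±ML) (≋±-sym (f-newPair u k)))))
        hit-newPair {u} u∈ (inj₂ z≈±μVu) =
          let (k , z≈±ML) = reach V z≈±μVu
          in Any.concatMap⁺ (tabulate ∘ newPair)
               (lose u∈ (Any.tabulate⁺ k (∈±ᵖ-resp-≋± (inj₂ z≈±ML) (≋±-sym (f-newPair u k)))))

      covers-lifted : ∀ Sp g → Covers p Sp f g → Covers n (lifted Sp) f (+ q * g)
      covers-lifted Sp g Sp-covers z = mk⇔ to from
        where
        HitsZ : Pair n → Set
        HitsZ pr = ⌊ z ⌋ ∈±ᵖ f pr [mod + n ]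

        to : Any HitsZ (lifted Sp) → Avoids (+ n) ⌊ z ⌋ (+ q * g)
        to hits = [ embedded , (λ new → q∤⇒Avoids g (newPairs-hit⇒q∤ new)) ]′ (Any.++⁻ (map embed Sp) hits)
          where
          embedded : Any HitsZ (map embed Sp) → Avoids (+ n) ⌊ z ⌋ (+ q * g)
          embedded hits =
            let (pr , pr∈ , hit) = find (Any.map⁻ hits)
                (w , z≡qw) = divide-by-q z (embed-hit⇒q∣ pr hit)
                w-hit = Equivalence.to (embed-hit⇔ ⌊ w ⌋ pr) (subst (λ x → x ∈±ᵖ f (embed pr) [mod + n ]) z≡qw hit)
            in subst (λ x → Avoids (+ n) x (+ q * g)) (sym z≡qw)
                 (Equivalence.from (Avoids-scale⇔ ⌊ w ⌋ g) (Equivalence.to (Sp-covers w) (lose pr∈ w-hit)))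

        from : Avoids (+ n) ⌊ z ⌋ (+ q * g) → Any HitsZ (lifted Sp)
        from avoids = [ multiple , (λ q∤z → Any.++⁺ʳ (map embed Sp) (q∤⇒newPairs-hit q∤z)) ]′ (toSum (+ q ∣? ⌊ z ⌋))
          where
          multiple : + q ∣ ⌊ z ⌋ → Any HitsZ (lifted Sp)
          multiple q∣z =
            let (w , z≡qw) = divide-by-q z q∣z
                w-hits = Equivalence.from (Sp-covers w)
                           (Equivalence.to (Avoids-scale⇔ ⌊ w ⌋ g) (subst (λ x → Avoids (+ n) x (+ q * g)) z≡qw avoids))
            in Any.++⁺ˡ (Any.map⁺ (Any.map (λ {pr} w-hit → subst (λ x → x ∈±ᵖ f (embed pr) [mod + n ]) (sym z≡qw)
                                                              (Equivalence.from (embed-hit⇔ ⌊ w ⌋ pr) w-hit)) w-hits))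

    aps-lifted : ∀ {α β : Fin p} {α₁ β₁ : Fin n} → APS p α β →
                 ⌊ α₁ ⌋ ≡ + q * ⌊ α ⌋ → ⌊ β₁ ⌋ ≡ + q * ⌊ β ⌋ →
                 (p ∸ 3) / 4 ℕ.+ h ℕ.* p ≡ (n ∸ 3) / 4 → APS n α₁ β₁
    aps-lifted aps α₁≡qα β₁≡qβ sizes =
      let (Sp , |Sp| , cover₁ , cover₂) = APS⇒Covers aps
      in Covers⇒APS (lifted Sp) (trans (length-lifted Sp) (trans (cong (ℕ._+ h ℕ.* p) |Sp|) sizes))
           (subst (Covers n (lifted Sp) values) (sym α₁≡qα)
             (covers-lifted values values-embed 1× c× values-newPair μc≈±μ1*√-1 Sp _ cover₁))
           (subst (Covers n (lifted Sp) diffSum) (sym β₁≡qβ)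
             (covers-lifted diffSum diffSum-embed [c-1]× [c+1]× diffSum-newPair μ[c+1]≈±μ[c-1]*√-1 Sp _ cover₂))

    divide-nonzero-by-q : (z : Fin n) → + q ∣ ⌊ z ⌋ → toℕ z ≢ 0 →
                          ∃ λ (w : Fin p) → ⌊ z ⌋ ≡ + q * ⌊ w ⌋ × toℕ w ≢ 0
    divide-nonzero-by-q z q∣z z≢0 =
      let (w , z≡qw) = divide-by-q z q∣z
      in w , z≡qw , λ w≡0 → z≢0 (ℤ.+-injective (trans z≡qw (trans (cong (λ k → + q * + k) w≡0) (ℤ.*-zeroʳ (+ q)))))

    2a²≈b²-descends : ∀ {a b a₁ b₁} → a₁ ≡ + q * a → b₁ ≡ + q * b →
                      + 2 * (a₁ * a₁) ≈ b₁ * b₁ [mod + n ] → + 2 * (a * a) ≈ b * b [mod + p ]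
    2a²≈b²-descends {a} {b} refl refl 2a₁²≈b₁² =
      ≈-cancelˡ p-prime (q∤p q-prime p-prime (p≢q ∘ sym))
        (≈-unscale (subst₂ (_≈_[mod + n ]) (lemma (+ q) a) (lemma′ (+ q) b) 2a₁²≈b₁²))
      where
      lemma : ∀ q a → + 2 * ((q * a) * (q * a)) ≡ q * (q * (+ 2 * (a * a)))
      lemma = solve-∀
      lemma′ : ∀ q b → (q * b) * (q * b) ≡ q * (q * (b * b))
      lemma′ = solve-∀

    record Descent (α₁ β₁ : Fin n) : Set where
      field
        α β : Fin p
        α₁≡qα : ⌊ α₁ ⌋ ≡ + q * ⌊ α ⌋
        β₁≡qβ : ⌊ β₁ ⌋ ≡ + q * ⌊ β ⌋
        α≢0 : toℕ α ≢ 0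
        β≢0 : toℕ β ≢ 0
        2α²≈β² : + 2 * (⌊ α ⌋ * ⌊ α ⌋) ≈ ⌊ β ⌋ * ⌊ β ⌋ [mod + p ]

    -- Since 2 is not a square mod q, 2 α₁² ≡ β₁² forces q ∣ α₁ and q ∣ β₁.
    descend : ∀ (α₁ β₁ : Fin n) → toℕ α₁ ≢ 0 → toℕ β₁ ≢ 0 →
              + 2 * (⌊ α₁ ⌋ * ⌊ α₁ ⌋) ≈ ⌊ β₁ ⌋ * ⌊ β₁ ⌋ [mod + n ] → Descent α₁ β₁
    descend α₁ β₁ α₁≢0 β₁≢0 2α₁²≈β₁² =
      let 2α₁²≈β₁²[q] = ≈-weaken q∣n 2α₁²≈β₁²
          (α , α₁≡qα , α≢0) = divide-nonzero-by-q α₁ (2a²≈b²⇒q∣a ⌊ α₁ ⌋ ⌊ β₁ ⌋ 2α₁²≈β₁²[q]) α₁≢0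
          (β , β₁≡qβ , β≢0) = divide-nonzero-by-q β₁ (2a²≈b²⇒q∣b ⌊ α₁ ⌋ ⌊ β₁ ⌋ 2α₁²≈β₁²[q]) β₁≢0
      in record { α = α ; β = β ; α₁≡qα = α₁≡qα ; β₁≡qβ = β₁≡qβ ; α≢0 = α≢0 ; β≢0 = β≢0
                ; 2α²≈β² = 2a²≈b²-descends α₁≡qα β₁≡qβ 2α₁²≈β₁² }

open import Defs
open import Data.Nat using (ℕ; _+_; _*_; _%_)
open import Data.Nat.Primality using (Prime)
open import Data.Fin using (Fin; toℕ)
open import Relation.Nullary using (¬_)
open import Relation.Binary.PropositionalEquality using (_≡_; _≢_)

open Lifting
open APSConditions using (2a²≡b²⇒≈; ≈⇒2a²≡b²)
import Data.Nat as ℕ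
import Data.Nat.Properties as ℕ
import Data.Nat.Tactic.RingSolver as ℕ-Solver
open import Data.Nat.DivMod using (_/_; m≡m%n+[m/n]*n; m*n/n≡m)
open import Data.Integer using (+_)
open import Data.Integer.Divisibility.Signed using (_∣_)
open Congruence using (0<k<n⇒n∤k)
open import Relation.Nullary using (contradiction)
open import Relation.Binary.PropositionalEquality using (sym; trans; cong; subst; subst₂)

x≡8*[x/8]+r : ∀ x r → x % 8 ≡ r → x ≡ 8 * (x / 8) + r
x≡8*[x/8]+r x r x%8≡r = trans (m≡m%n+[m/n]*n x 8) (trans (cong (_+ (x / 8) * 8) x%8≡r)
                     (trans (ℕ.+-comm r _) (cong (_+ r) (ℕ.*-comm (x / 8) 8))))

aps-sizes : ∀ s t → ((8 * s + 7) ℕ.∸ 3) / 4 + ℕ.suc (t + t) * (8 * s + 7) ≡ ((8 * s + 7) * (8 * t + 5) ℕ.∸ 3) / 4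
aps-sizes s t = trans (cong (_+ ℕ.suc (t + t) * (8 * s + 7)) [p-3]/4) (sym [pq-3]/4)
  where
  quotient-of : ∀ X → (X * 4 + 3 ℕ.∸ 3) / 4 ≡ X
  quotient-of X = trans (cong (_/ 4) (ℕ.m+n∸n≡m (X * 4) 3)) (m*n/n≡m X 4)
  [p-3]/4 : ((8 * s + 7) ℕ.∸ 3) / 4 ≡ 1 + 2 * s
  [p-3]/4 = trans (cong (λ x → (x ℕ.∸ 3) / 4) (lemma₁ s)) (quotient-of (1 + 2 * s))
    where
    lemma₁ : ∀ s → 8 * s + 7 ≡ (1 + 2 * s) * 4 + 3
    lemma₁ = ℕ-Solver.solve-∀
  [pq-3]/4 : ((8 * s + 7) * (8 * t + 5) ℕ.∸ 3) / 4 ≡ 1 + 2 * s + ℕ.suc (t + t) * (8 * s + 7)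
  [pq-3]/4 = trans (cong (λ x → (x ℕ.∸ 3) / 4) (lemma₂ s t)) (quotient-of (1 + 2 * s + ℕ.suc (t + t) * (8 * s + 7)))
    where
    lemma₂ : ∀ s t → (8 * s + 7) * (8 * t + 5) ≡ (1 + 2 * s + ℕ.suc (t + t) * (8 * s + 7)) * 4 + 3
    lemma₂ = ℕ-Solver.solve-∀

mainTheorem18 : (p q : ℕ) → Prime p → Prime q → p % 8 ≡ 7 → q % 8 ≡ 5 →
    (∀ (α β : Fin p) → toℕ α ≢ 0 → toℕ β ≢ 0 →
      (2 * (toℕ α * toℕ α)) ≡ (toℕ β * toℕ β) [mod p ] → APS p α β) →
    ∀ (α₁ β₁ : Fin (p * q)) → toℕ α₁ ≢ 0 → toℕ β₁ ≢ 0 →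
      (2 * (toℕ α₁ * toℕ α₁)) ≡ (toℕ β₁ * toℕ β₁) [mod (p * q) ] → APS (p * q) α₁ β₁
mainTheorem18 p q p-prime q-prime p%8≡7 q%8≡5 aps-p α₁ β₁ α₁≢0 β₁≢0 2α₁²≡β₁² =
  aps-lifted (aps-p α β α≢0 β≢0 (≈⇒2a²≡b² (toℕ α) (toℕ β) 2α²≈β²)) α₁≡qα β₁≡qβ sizes
  where
  s t : ℕ
  s = p / 8
  t = q / 8
  p≡8s+7 : p ≡ 8 * s + 7
  p≡8s+7 = x≡8*[x/8]+r p 7 p%8≡7
  q≡8t+5 : q ≡ 8 * t + 5
  q≡8t+5 = x≡8*[x/8]+r q 5 q%8≡5
  p≢q : p ≢ q
  p≢q p≡q = contradiction (trans (sym p%8≡7) (trans (cong (_% 8) p≡q) q%8≡5)) λ ()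
  p≥7 : 7 ℕ.≤ p
  p≥7 = subst (7 ℕ.≤_) (sym p≡8s+7) (ℕ.m≤n+m 7 (8 * s))
  p∤2 : ¬ (+ p ∣ + 2)
  p∤2 = 0<k<n⇒n∤k (ℕ.s≤s ℕ.z≤n) (ℕ.≤-trans (ℕ.m≤m+n 3 4) p≥7)
  p∤3 : ¬ (+ p ∣ + 3)
  p∤3 = 0<k<n⇒n∤k (ℕ.s≤s ℕ.z≤n) (ℕ.≤-trans (ℕ.m≤m+n 4 3) p≥7)
  open Construction p-prime q-prime p≢q p∤2 p∤3 t q≡8t+5
  descent : Descent α₁ β₁
  descent = descend α₁ β₁ α₁≢0 β₁≢0 (2a²≡b²⇒≈ (toℕ α₁) (toℕ β₁) 2α₁²≡β₁²)
  open Descent descent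
  sizes : (p ℕ.∸ 3) / 4 + ℕ.suc (t + t) * p ≡ (p * q ℕ.∸ 3) / 4
  sizes = subst₂ (λ p′ q′ → (p′ ℕ.∸ 3) / 4 + ℕ.suc (t + t) * p′ ≡ (p′ * q′ ℕ.∸ 3) / 4)
                 (sym p≡8s+7) (sym q≡8t+5) (aps-sizes s t)
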